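{- For integers $p,q\ge1$ and $a,b\ge0$ with $a\le q$ and $a+b\le p+1$, \begin{align*} &(-1)^{a+b}S^{(r)}_{[\,p+1\,|\,q+b-1\,]}(X)\,S^{(r-1)}_{[\,p-1\,|\,q-a\,]^{p-a-b+1}}(X)\\ &=S^{(r)}_{[\,p\,|\,q+b-1\,]}(X)\,S^{(r-1)}_{[\,p\,|\,q-a+1\,]}(X)-S^{(r)}_{[\,p\,|\,q-a\,]}(X)\,S^{(r-1)}_{[\,p\,|\,q+b\,]}(X)\\ &\quad+\sum_{t=0}^{a+b-3}(-1)^{t-1}S^{(r)}_{[\,p\,|\,q+b-1\,]_{q-a+t+1}}(X)\,S^{(r-1)}_{[\,p-1\,|\,q-a\,]^{p-t-1}}(X). \end{align*}
   Context: $[\,p\,|\,q\,]$ denotes the rectangular partition $(q^p)$; $[\,p\,|\,q\,]^{l}_{k}=((q+1)^l,q^{p-l},k)$, $[\,p\,|\,q\,]^l=[\,p\,|\,q\,]^l_0$, $[\,p\,|\,q\,]_k=[\,p\,|\,q\,]^0_k$. Let $N$ be a positive integer and $X=[x_{i,j}]_{1\le i,j\le N}$ a matrix of indeterminates; over $\mathbb{C}(X)$ write the Gauss decomposition $X=X_-X_0X_+$ ($X_-$ lower unitriangular, $X_0$ diagonal, $X_+$ upper unitriangular). For $0\le r\le N$ and a partition $\lambda\subset((N-r)^r)$, $S^{(r)}_\lambda(X)$ is the minor of $X_+$ with rows $\{1,\ldots,r\}$ and columns $\{\lambda_{r+1-a}+a:1\le a\le r\}$; $S^{(r)}_\varnothing=1$,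 and $S^{(r)}_\lambda=0$ if $\lambda$ is not a partition. $N$ is assumed large enough that everything is defined. -}

module Defs where

open import Level using (_⊔_)
open import Algebra.Bundles using (CommutativeRing)
import Data.Nat as ℕ
open import Data.Nat using (ℕ; zero; suc; _∸_; _≤ᵇ_; _<ᵇ_; _≤_; _<_)
open import Data.Nat.Properties using (_<?_)
open import Data.Fin using (Fin; toℕ; punchIn; fromℕ<)
import Data.Fin as F
open import Data.Bool using (Bool; true; false; if_then_else_; _∧_)
open import Data.List using (List; []; _∷_; _++_; replicate)
open import Data.Maybe using (Maybe; just; nothing)
open import Relation.Nullary using (yes; no)
open import Data.Product using (Σ)
open import Relation.Binary.PropositionalEquality using (_≢_)

-- A partition is represented by a finite list of parts (zeros allowed,
-- trailing zeros are irrelevant).  The symbol  [ p | q ]^l_k  is the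
-- sequence ((q+1)^l, q^(p-l), k).  When l > p this is not a sequence
-- at all (negative multiplicity); we represent that by `nothing`, and
-- it is treated like any other non-partition (S = 0).
box : (p q l k : ℕ) → Maybe (List ℕ)
box p q l k =
  if l ≤ᵇ p then just (replicate l (suc q) ++ replicate (p ∸ l) q ++ (k ∷ []))
  else nothing

rect : ℕ → ℕ → Maybe (List ℕ)
rect p q = box p q 0 0

boxU : ℕ → ℕ → ℕ → Maybe (List ℕ)
boxU p q l = box p q l 0

boxL : ℕ → ℕ → ℕ → Maybe (List ℕ)
boxL p q k = box p q 0 k

nonincr : List ℕ → Bool
nonincr [] = true
nonincr (x ∷ []) = true
nonincr (x ∷ y ∷ ys) = (y ≤ᵇ x) ∧ nonincr (y ∷ ys)

-- i-th part (0-indexed), 0 beyond the end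
part : List ℕ → ℕ → ℕ
part [] i = 0
part (x ∷ xs) zero = x
part (x ∷ xs) (suc i) = part xs i

module Over {c ℓ} (R : CommutativeRing c ℓ) where
  open CommutativeRing R

  Mat : ℕ → Set c
  Mat n = Fin n → Fin n → Carrier

  sgn : ℕ → Carrier → Carrier
  sgn zero x = x
  sgn (suc n) x = - sgn n x

  ∑ : (n : ℕ) → (Fin n → Carrier) → Carrier
  ∑ zero f = 0#
  ∑ (suc n) f = f F.zero + ∑ n (λ i → f (F.suc i))

  sumTo : ℕ → (ℕ → Carrier) → Carrier
  sumTo zero f = 0#
  sumTo (suc n) f = sumTo n f + f n

  det : (n : ℕ) → Mat n → Carrier
  det zero M = 1#
  det (suc n) M =
    ∑ (suc n) (λ j → sgn (toℕ j) (M F.zero j * det n (λ i k → M (F.suc i) (punchIn j k))))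

  _⊗_ : ∀ {n} → Mat n → Mat n → Mat n
  (A ⊗ B) i j = ∑ _ (λ k → A i k * B k j)

  record IsGaussDecomposition (n : ℕ) (X X₋ X₀ X₊ : Mat n) : Set (c ⊔ ℓ) where
    field
      lower-diag  : ∀ i → X₋ i i ≈ 1#
      lower-upper : ∀ i j → toℕ i < toℕ j → X₋ i j ≈ 0#
      diag-off    : ∀ i j → i ≢ j → X₀ i j ≈ 0#
      diag-inv    : ∀ i → Σ Carrier (λ y → X₀ i i * y ≈ 1#)
      upper-diag  : ∀ i → X₊ i i ≈ 1#
      upper-lower : ∀ i j → toℕ j < toℕ i → X₊ i j ≈ 0#
      product     : ∀ i j → X i j ≈ ((X₋ ⊗ X₀) ⊗ X₊) i j

  -- entries of an N×N matrix indexed by naturals (0 outside the range;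
  -- never used outside the range under the hypotheses of the theorem)
  entry : ∀ {N} → Mat N → ℕ → ℕ → Carrier
  entry {N} A i j with i <? N | j <? N
  ... | yes i<N | yes j<N = A (fromℕ< i<N) (fromℕ< j<N)
  ... | _       | _       = 0#

  -- S^{(r)}_λ(X) computed from the upper unitriangular factor X₊ of an
  -- N×N Gauss decomposition: the minor of X₊ with rows {1..r} and
  -- columns {λ_{r+1-a} + a : 1 ≤ a ≤ r} (here 0-indexed: row i, column
  -- λ_{r-1-a'} + a' for a' = a - 1).  S = 0 if λ is not a partition.
  -- The partition is required to fit into the box ((N-r)^r) for the
  -- minor to be defined; outside this range we return 0 (the theorem's
  -- hypotheses guarantee that every symbol occurring fits).
  S : ∀ {N} → Mat N → (r : ℕ) → Maybe (List ℕ) → Carrier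
  S U r nothing = 0#
  S {N} U r (just lam) =
    if nonincr lam ∧ (part lam r ≤ᵇ 0) ∧ (part lam 0 ℕ.+ r ≤ᵇ N)
    then det r (λ i a → entry U (toℕ i) (part lam (r ∸ suc (toℕ a)) ℕ.+ toℕ a))
    else 0#

-- It is a Plücker relation. Writing Δ m f for the minor on
-- the first m rows and the columns f 0, …, f (m - 1),
--   ∑_j (-1)^j Δ (n+1) (κ_j, ι) · Δ n (κ without κ_j) = Δ n ι · Δ (n+1) κ,
-- because expanding Δ (n+1) (k, ι) along its first column makes the left-hand side a combination
-- of determinants with a repeated row, except for one. Take for κ the columns of [p | w] on
-- r = n + 1 rows and for ι those of [p | w + a + b] on n rows, where w = q - a. The terms in which
-- κ_j is also a column of ι vanish; moving κ_j to its sorted position turns the remaining a + b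
-- terms into the products on the right of the theorem, and the last of them into its left side.

module Submission where

open import Defs
open import Algebra.Bundles using (CommutativeRing)
open import Data.Nat as ℕ using (ℕ; zero; suc; _≤_; _<_; _∸_; z≤n; s≤s)
import Data.Nat.Properties as ℕₚ
open import Data.Nat.Solver using (module +-*-Solver)
open +-*-Solver using (solve; _:+_; _:=_; con)
open import Data.Bool using (true; false; _∧_)
open import Data.Bool.Properties using (T-≡)
open import Data.List using (List; []; _∷_; _++_; replicate)
open import Data.Maybe using (just; nothing)
open import Data.Product using (_,_)
open import Data.Fin as Fin using (Fin; toℕ; punchIn)
open import Data.Fin.Properties using (toℕ<n; toℕ-inject₁; toℕ-fromℕ)
open import Function using (_∘_; Equivalence)
open import Relation.Nullary using (contradiction)
open import Relation.Binary.PropositionalEquality as ≡ using (_≡_; cong)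

skip : ℕ → ℕ → ℕ
skip zero    k       = suc k
skip (suc j) zero    = zero
skip (suc j) (suc k) = suc (skip j k)

toℕ-punchIn : ∀ {n} (j : Fin (suc n)) (k : Fin n) → toℕ (punchIn j k) ≡ skip (toℕ j) (toℕ k)
toℕ-punchIn Fin.zero    k           = ≡.refl
toℕ-punchIn (Fin.suc j) Fin.zero    = ≡.refl
toℕ-punchIn (Fin.suc j) (Fin.suc k) = cong suc (toℕ-punchIn j k)

skip-< : ∀ {j k} → k < j → skip j k ≡ k
skip-< {k = zero}  (s≤s _)   = ≡.refl
skip-< {k = suc k} (s≤s k<j) = cong suc (skip-< k<j)

skip-≥ : ∀ {j k} → j ≤ k → skip j k ≡ suc k
skip-≥ z≤n       = ≡.refl
skip-≥ (s≤s j≤k) = cong suc (skip-≥ j≤k)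

skip-skip : ∀ {a b} l → a ≤ b → skip a (skip b l) ≡ skip (suc b) (skip a l)
skip-skip l       z≤n       = ≡.refl
skip-skip zero    (s≤s a≤b) = ≡.refl
skip-skip (suc l) (s≤s a≤b) = cong suc (skip-skip l a≤b)

swapAdj : ℕ → ℕ → ℕ
swapAdj zero    zero          = 1
swapAdj zero    (suc zero)    = 0
swapAdj zero    (suc (suc k)) = suc (suc k)
swapAdj (suc i) zero          = zero
swapAdj (suc i) (suc k)       = suc (swapAdj i k)

swapAdj-self : ∀ i → swapAdj i i ≡ suc i
swapAdj-self zero    = ≡.refl
swapAdj-self (suc i) = cong suc (swapAdj-self i)

swapAdj-suc : ∀ i → swapAdj i (suc i) ≡ i
swapAdj-suc zero    = ≡.refl
swapAdj-suc (suc i) = cong suc (swapAdj-suc i)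

swapAdj-< : ∀ {i k} → k < i → swapAdj i k ≡ k
swapAdj-< {k = zero}  (s≤s _)   = ≡.refl
swapAdj-< {k = suc k} (s≤s k<i) = cong suc (swapAdj-< k<i)

swapAdj-> : ∀ {i k} → suc i < k → swapAdj i k ≡ k
swapAdj-> {zero}  (s≤s (s≤s _)) = ≡.refl
swapAdj-> {suc i} (s≤s i<k)     = cong suc (swapAdj-> i<k)

swapAdj-skip : ∀ i k → swapAdj i (skip i k) ≡ skip (suc i) k
swapAdj-skip zero    zero    = ≡.refl
swapAdj-skip zero    (suc k) = ≡.refl
swapAdj-skip (suc i) zero    = ≡.refl
swapAdj-skip (suc i) (suc k) = cong suc (swapAdj-skip i k)

swapAdj-skip-suc : ∀ i k → swapAdj i (skip (suc i) k) ≡ skip i k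
swapAdj-skip-suc zero    zero    = ≡.refl
swapAdj-skip-suc zero    (suc k) = ≡.refl
swapAdj-skip-suc (suc i) zero    = ≡.refl
swapAdj-skip-suc (suc i) (suc k) = cong suc (swapAdj-skip-suc i k)

swapAdj-skip-≤ : ∀ {i j} k → j ≤ i → swapAdj (suc i) (skip j k) ≡ skip j (swapAdj i k)
swapAdj-skip-≤ k       z≤n       = ≡.refl
swapAdj-skip-≤ zero    (s≤s j≤i) = ≡.refl
swapAdj-skip-≤ (suc k) (s≤s j≤i) = cong suc (swapAdj-skip-≤ k j≤i)

swapAdj-skip-> : ∀ {i j} k → suc (suc i) ≤ j → swapAdj i (skip j k) ≡ skip j (swapAdj i k)
swapAdj-skip-> {zero}  zero          (s≤s (s≤s _)) = ≡.refl
swapAdj-skip-> {zero}  (suc zero)    (s≤s (s≤s _)) = ≡.refl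
swapAdj-skip-> {zero}  (suc (suc k)) (s≤s (s≤s _)) = ≡.refl
swapAdj-skip-> {suc i} zero          (s≤s _)       = ≡.refl
swapAdj-skip-> {suc i} (suc k)       (s≤s i<j)     = cong suc (swapAdj-skip-> k i<j)

cons : ℕ → (ℕ → ℕ) → ℕ → ℕ
cons x f zero    = x
cons x f (suc k) = f k

rotate : ℕ → ℕ → ℕ
rotate m = cons m (skip m)

rotate-suc : ∀ m k → rotate (suc m) k ≡ swapAdj m (rotate m k)
rotate-suc m zero    = ≡.sym (swapAdj-self m)
rotate-suc m (suc k) = ≡.sym (swapAdj-skip m k)

data Position (i : ℕ) : ℕ → Set where
  before : ∀ {j} → j < i → Position i j
  at     : Position i i
  next   : Position i (suc i)
  after  : ∀ {j} → suc i < j → Position i j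

position : ∀ i j → Position i j
position zero    zero          = at
position zero    (suc zero)    = next
position zero    (suc (suc j)) = after (s≤s (s≤s z≤n))
position (suc i) zero          = before (s≤s z≤n)
position (suc i) (suc j) with position i j
... | before j<i = before (s≤s j<i)
... | at         = at
... | next       = next
... | after i<j  = after (s≤s i<j)

module Minors {a ℓ} (R : CommutativeRing a ℓ) where

  open CommutativeRing R hiding (zero)
  open Over R using (sgn; det; ∑; sumTo)
  open import Algebra.Properties.Ring ring
    using (-‿involutive; -‿distribˡ-*; -‿distribʳ-*; -‿+-comm; -0#≈0#; +-inverseʳ-unique)
  open import Algebra.Properties.CommutativeMonoid.Sum +-commutativeMonoid
    using (sum; ∑-distrib-+; ∑-comm; sum-cong-≋; sum-cong-≗; sum-replicate-zero; sum-init-last)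
  open import Algebra.Properties.Semiring.Sum semiring using (*-distribˡ-sum; *-distribʳ-sum)
  open import Algebra.Properties.CommutativeSemigroup *-commutativeSemigroup using (x∙yz≈y∙xz)
  open import Relation.Binary.Reasoning.Setoid setoid

  sgn-cong : ∀ n {x y} → x ≈ y → sgn n x ≈ sgn n y
  sgn-cong zero    x≈y = x≈y
  sgn-cong (suc n) x≈y = -‿cong (sgn-cong n x≈y)

  sgn-*ˡ : ∀ n x y → sgn n (x * y) ≈ sgn n x * y
  sgn-*ˡ zero    x y = refl
  sgn-*ˡ (suc n) x y = trans (-‿cong (sgn-*ˡ n x y)) (-‿distribˡ-* _ _)

  sgn-*ʳ : ∀ n x y → sgn n (x * y) ≈ x * sgn n y
  sgn-*ʳ zero    x y = refl
  sgn-*ʳ (suc n) x y = trans (-‿cong (sgn-*ʳ n x y)) (-‿distribʳ-* _ _)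

  sgn-+ : ∀ n x y → sgn n (x + y) ≈ sgn n x + sgn n y
  sgn-+ zero    x y = refl
  sgn-+ (suc n) x y = trans (-‿cong (sgn-+ n x y)) (sym (-‿+-comm _ _))

  sgn-‿ : ∀ n x → sgn n (- x) ≈ - sgn n x
  sgn-‿ zero    x = refl
  sgn-‿ (suc n) x = -‿cong (sgn-‿ n x)

  sgn-0# : ∀ n → sgn n 0# ≈ 0#
  sgn-0# zero    = refl
  sgn-0# (suc n) = trans (-‿cong (sgn-0# n)) -0#≈0#

  sgn-+ℕ : ∀ m n x → sgn (m ℕ.+ n) x ≈ sgn m (sgn n x)
  sgn-+ℕ zero    n x = refl
  sgn-+ℕ (suc m) n x = -‿cong (sgn-+ℕ m n x)

  sgn-comm : ∀ m n x → sgn m (sgn n x) ≈ sgn n (sgn m x)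
  sgn-comm m n x = begin
    sgn m (sgn n x)   ≈⟨ sgn-+ℕ m n x ⟨
    sgn (m ℕ.+ n) x   ≡⟨ cong (λ k → sgn k x) (ℕₚ.+-comm m n) ⟩
    sgn (n ℕ.+ m) x   ≈⟨ sgn-+ℕ n m x ⟩
    sgn n (sgn m x)   ∎

  sgn-involutive : ∀ n x → sgn n (sgn n x) ≈ x
  sgn-involutive zero    x = refl
  sgn-involutive (suc n) x = begin
    - sgn n (- sgn n x)   ≈⟨ -‿cong (sgn-‿ n _) ⟩
    - - sgn n (sgn n x)   ≈⟨ -‿involutive _ ⟩
    sgn n (sgn n x)       ≈⟨ sgn-involutive n x ⟩
    x                     ∎

  sgn-sgn-* : ∀ n x y → sgn n (sgn n x * y) ≈ x * y
  sgn-sgn-* n x y = trans (sgn-cong n (sym (sgn-*ˡ n x y))) (sgn-involutive n _)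

  sgn-*-sgn : ∀ n x y → sgn n x * sgn n y ≈ x * y
  sgn-*-sgn n x y = begin
    sgn n x * sgn n y     ≈⟨ sgn-*ˡ n x _ ⟨
    sgn n (x * sgn n y)   ≈⟨ sgn-cong n (sgn-*ʳ n x y) ⟨
    sgn n (sgn n (x * y)) ≈⟨ sgn-involutive n _ ⟩
    x * y                 ∎

  sgn≈0 : ∀ n {x} → x ≈ 0# → sgn n x ≈ 0#
  sgn≈0 n x≈0 = trans (sgn-cong n x≈0) (sgn-0# n)

  *-≈0ʳ : ∀ x {y} → y ≈ 0# → x * y ≈ 0#
  *-≈0ʳ x y≈0 = trans (*-congˡ y≈0) (zeroʳ x)

  *-≈0ˡ : ∀ {x} y → x ≈ 0# → x * y ≈ 0#
  *-≈0ˡ y x≈0 = trans (*-congʳ x≈0) (zeroˡ y)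

  sgn-*-‿ : ∀ j x y → sgn j (x * - y) ≈ - sgn j (x * y)
  sgn-*-‿ j x y = trans (sgn-cong j (sym (-‿distribʳ-* x y))) (sgn-‿ j _)

  -- Opaque, like Det below, so that unification recovers f from ∑< n f.
  opaque
    ∑< : ℕ → (ℕ → Carrier) → Carrier
    ∑< n f = sum {n} (λ i → f (toℕ i))

  opaque
    unfolding ∑<

    ∑<-empty : ∀ (f : ℕ → Carrier) → ∑< 0 f ≡ 0#
    ∑<-empty f = ≡.refl

    ∑<-suc : ∀ n (f : ℕ → Carrier) → ∑< (suc n) f ≡ f 0 + ∑< n (f ∘ suc)
    ∑<-suc n f = ≡.refl

    ∑<-cong : ∀ n {f g : ℕ → Carrier} → (∀ i → i < n → f i ≈ g i) → ∑< n f ≈ ∑< n g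
    ∑<-cong n f≈g = sum-cong-≋ (λ i → f≈g (toℕ i) (toℕ<n i))

    ∑<-zero : ∀ n {f : ℕ → Carrier} → (∀ i → i < n → f i ≈ 0#) → ∑< n f ≈ 0#
    ∑<-zero n f≈0 = trans (∑<-cong n f≈0) (sum-replicate-zero n)

    ∑<-+ : ∀ n (f g : ℕ → Carrier) → ∑< n (λ i → f i + g i) ≈ ∑< n f + ∑< n g
    ∑<-+ n f g = ∑-distrib-+ {n} (f ∘ toℕ) (g ∘ toℕ)

    ∑<-comm : ∀ m n (f : ℕ → ℕ → Carrier) →
              ∑< m (λ i → ∑< n (f i)) ≈ ∑< n (λ j → ∑< m (λ i → f i j))
    ∑<-comm m n f = ∑-comm {m} {n} (λ i j → f (toℕ i) (toℕ j))

    *-distribˡ-∑< : ∀ n x (f : ℕ → Carrier) → x * ∑< n f ≈ ∑< n (λ i → x * f i)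
    *-distribˡ-∑< n x f = *-distribˡ-sum {n} x (f ∘ toℕ)

    *-distribʳ-∑< : ∀ n x (f : ℕ → Carrier) → ∑< n f * x ≈ ∑< n (λ i → f i * x)
    *-distribʳ-∑< n x f = *-distribʳ-sum {n} x (f ∘ toℕ)

    ∑<-last : ∀ n (f : ℕ → Carrier) → ∑< (suc n) f ≈ ∑< n f + f n
    ∑<-last n f = trans (sum-init-last {n} (f ∘ toℕ))
      (+-cong (reflexive (sum-cong-≗ {n} (cong f ∘ toℕ-inject₁))) (reflexive (cong f (toℕ-fromℕ n))))

    ∑<-split : ∀ m n (f : ℕ → Carrier) → ∑< (m ℕ.+ n) f ≈ ∑< m f + ∑< n (λ i → f (m ℕ.+ i))
    ∑<-split zero    n f = sym (+-identityˡ _)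
    ∑<-split (suc m) n f = trans (+-congˡ (∑<-split m n (f ∘ suc))) (sym (+-assoc _ _ _))

    ∑<-sgn : ∀ n k (f : ℕ → Carrier) → sgn k (∑< n f) ≈ ∑< n (λ i → sgn k (f i))
    ∑<-sgn zero    k f = sgn-0# k
    ∑<-sgn (suc n) k f = trans (sgn-+ k _ _) (+-congˡ (∑<-sgn n k (f ∘ suc)))

    ∑<-swapAdj : ∀ n i (f : ℕ → Carrier) → suc i < n → ∑< n (f ∘ swapAdj i) ≈ ∑< n f
    ∑<-swapAdj (suc (suc n)) zero    f _ = begin
      ∑< (suc (suc n)) (f ∘ swapAdj 0)   ≡⟨⟩
      f 1 + (f 0 + rest)                 ≈⟨ +-assoc _ _ _ ⟨
      (f 1 + f 0) + rest                 ≈⟨ +-congʳ (+-comm _ _) ⟩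
      (f 0 + f 1) + rest                 ≈⟨ +-assoc _ _ _ ⟩
      f 0 + (f 1 + rest)                 ≡⟨⟩
      ∑< (suc (suc n)) f                 ∎
      where
      rest : Carrier
      rest = ∑< n (f ∘ suc ∘ suc)
    ∑<-swapAdj (suc n) (suc i) f (s≤s i<n) = +-congˡ (∑<-swapAdj n i (f ∘ suc) i<n)

  ∑<-head : ∀ n {f : ℕ → Carrier} → 0 < n → (∀ i → 0 < i → i < n → f i ≈ 0#) → ∑< n f ≈ f 0
  ∑<-head (suc n) {f} _ f≈0 = begin
    ∑< (suc n) f         ≡⟨ ∑<-suc n f ⟩
    f 0 + ∑< n (f ∘ suc) ≈⟨ +-congˡ (∑<-zero n (λ i i<n → f≈0 (suc i) (s≤s z≤n) (s≤s i<n))) ⟩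
    f 0 + 0#             ≈⟨ +-identityʳ (f 0) ⟩
    f 0                  ∎

  ∑<-linear : ∀ n m {F : ℕ → Carrier} (a : ℕ → Carrier) (G : ℕ → ℕ → Carrier) →
              (∀ j → j < n → F j ≈ ∑< m (λ k → a k * G k j)) →
              ∑< n F ≈ ∑< m (λ k → a k * ∑< n (G k))
  ∑<-linear n m {F} a G F≈ = begin
    ∑< n F                                  ≈⟨ ∑<-cong n F≈ ⟩
    ∑< n (λ j → ∑< m (λ k → a k * G k j))   ≈⟨ ∑<-comm n m (λ j k → a k * G k j) ⟩
    ∑< m (λ k → ∑< n (λ j → a k * G k j))   ≈⟨ ∑<-cong m (λ k _ → *-distribˡ-∑< n (a k) (G k)) ⟨
    ∑< m (λ k → a k * ∑< n (G k))           ∎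

  sgn-*-∑< : ∀ m j x (a y : ℕ → Carrier) →
             sgn j (x * ∑< m (λ k → a k * y k)) ≈ ∑< m (λ k → a k * sgn j (x * y k))
  sgn-*-∑< m j x a y = begin
    sgn j (x * ∑< m (λ k → a k * y k))      ≈⟨ sgn-cong j (*-distribˡ-∑< m x _) ⟩
    sgn j (∑< m (λ k → x * (a k * y k)))    ≈⟨ ∑<-sgn m j _ ⟩
    ∑< m (λ k → sgn j (x * (a k * y k)))    ≈⟨ ∑<-cong m (λ k _ →
                                                 trans (sgn-cong j (x∙yz≈y∙xz x (a k) (y k))) (sgn-*ʳ j _ _)) ⟩
    ∑< m (λ k → a k * sgn j (x * y k))      ∎

  sgn-∑<-* : ∀ m j x (a y : ℕ → Carrier) →
             sgn j (∑< m (λ k → a k * y k) * x) ≈ ∑< m (λ k → a k * sgn j (y k * x))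
  sgn-∑<-* m j x a y = begin
    sgn j (∑< m (λ k → a k * y k) * x)      ≈⟨ sgn-cong j (*-distribʳ-∑< m x _) ⟩
    sgn j (∑< m (λ k → (a k * y k) * x))    ≈⟨ ∑<-sgn m j _ ⟩
    ∑< m (λ k → sgn j ((a k * y k) * x))    ≈⟨ ∑<-cong m (λ k _ → trans (sgn-cong j (*-assoc _ _ _)) (sgn-*ʳ j _ _)) ⟩
    ∑< m (λ k → a k * sgn j (y k * x))      ∎

  sumTo≈∑< : ∀ n (f : ℕ → Carrier) → sumTo n f ≈ ∑< n f
  sumTo≈∑< zero    f = reflexive (≡.sym (∑<-empty f))
  sumTo≈∑< (suc n) f = trans (+-congʳ (sumTo≈∑< n f)) (sym (∑<-last n f))

  -- Determinants of ℕ-indexed matrices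

  Matrix : Set a
  Matrix = ℕ → ℕ → Carrier

  opaque
    Det : ℕ → Matrix → Carrier
    Det n A = det n (λ i j → A (toℕ i) (toℕ j))

  minor : ℕ → Matrix → Matrix
  minor j A i k = A (suc i) (skip j k)

  rows : (ℕ → ℕ) → Matrix → Matrix
  rows ρ A i = A (ρ i)

  cols : (ℕ → ℕ) → Matrix → Matrix
  cols κ A i j = A i (κ j)

  ∑≡sum : ∀ n (f : Fin n → Carrier) → ∑ n f ≡ sum f
  ∑≡sum zero    f = ≡.refl
  ∑≡sum (suc n) f = cong (f Fin.zero +_) (∑≡sum n (f ∘ Fin.suc))

  ∑-cong : ∀ n {f g : Fin n → Carrier} → (∀ i → f i ≈ g i) → ∑ n f ≈ ∑ n g
  ∑-cong n {f} {g} f≈g = begin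
    ∑ n f   ≡⟨ ∑≡sum n f ⟩
    sum f   ≈⟨ sum-cong-≋ f≈g ⟩
    sum g   ≡⟨ ∑≡sum n g ⟨
    ∑ n g   ∎

  det-cong : ∀ n {M M′ : Over.Mat R n} → (∀ i j → M i j ≈ M′ i j) → det n M ≈ det n M′
  det-cong zero    M≈M′ = refl
  det-cong (suc n) M≈M′ = ∑-cong (suc n) (λ j → sgn-cong (toℕ j)
    (*-cong (M≈M′ Fin.zero j) (det-cong n (λ i k → M≈M′ (Fin.suc i) (punchIn j k)))))

  opaque
    unfolding Det ∑<

    Det-cong : ∀ n {A B : Matrix} → (∀ i j → i < n → j < n → A i j ≈ B i j) → Det n A ≈ Det n B
    Det-cong n A≈B = det-cong n (λ i j → A≈B (toℕ i) (toℕ j) (toℕ<n i) (toℕ<n j))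

    Det-zero : ∀ A → Det 0 A ≈ 1#
    Det-zero A = refl

    Det-laplace : ∀ n A → Det (suc n) A ≈ ∑< (suc n) (λ j → sgn j (A 0 j * Det n (minor j A)))
    Det-laplace n A = begin
      det (suc n) (λ i j → A (toℕ i) (toℕ j))
        ≈⟨ ∑-cong (suc n) (λ j → sgn-cong (toℕ j) (*-congˡ {A 0 (toℕ j)} (det-cong n (λ i k →
             reflexive (cong (A (suc (toℕ i))) (toℕ-punchIn j k)))))) ⟩
      ∑ (suc n) (λ j → sgn (toℕ j) (A 0 (toℕ j) * Det n (minor (toℕ j) A)))
        ≡⟨ ∑≡sum (suc n) (λ j → sgn (toℕ j) (A 0 (toℕ j) * Det n (minor (toℕ j) A))) ⟩
      ∑< (suc n) (λ j → sgn j (A 0 j * Det n (minor j A))) ∎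

  Det-cong≡ : ∀ n {A B : Matrix} → (∀ i j → A i j ≡ B i j) → Det n A ≈ Det n B
  Det-cong≡ n A≡B = Det-cong n (λ i j _ _ → reflexive (A≡B i j))

  -- The term (j, k) = (a, b) with a ≤ b cancels the term (b + 1, a): both use the columns a and b + 1.
  alternating-double-sum≈0 : ∀ m (W M : ℕ → ℕ → Carrier) →
    (∀ a b → W a b ≈ W b a) → (∀ a b → a ≤ b → M a b ≈ M (suc b) a) →
    ∑< (suc m) (λ j → sgn j (∑< m (λ k → sgn k (W j (skip j k) * M j k)))) ≈ 0#
  alternating-double-sum≈0 zero    W M _     _      = ∑<-zero 1 (λ j _ → sgn≈0 j (reflexive (∑<-empty _)))
  alternating-double-sum≈0 (suc m) W M W-sym M-swap = begin
    ∑< (suc (suc m)) (λ j → sgn j (∑< (suc m) (λ k → sgn k (T j k))))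
      ≡⟨ ∑<-suc (suc m) _ ⟩
    ∑< (suc m) (λ k → sgn k (T 0 k)) + ∑< (suc m) (λ j → - sgn j (∑< (suc m) (λ k → sgn k (T (suc j) k))))
      ≈⟨ +-congˡ (∑<-cong (suc m) (λ j _ → peel j)) ⟩
    ∑< (suc m) (λ k → sgn k (T 0 k)) + ∑< (suc m) (λ j → - sgn j (T (suc j) 0) + inner j)
      ≈⟨ +-congˡ (∑<-+ (suc m) _ inner) ⟩
    ∑< (suc m) (λ k → sgn k (T 0 k)) + (∑< (suc m) (λ j → - sgn j (T (suc j) 0)) + ∑< (suc m) inner)
      ≈⟨ +-assoc _ _ _ ⟨
    (∑< (suc m) (λ k → sgn k (T 0 k)) + ∑< (suc m) (λ j → - sgn j (T (suc j) 0))) + ∑< (suc m) inner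
      ≈⟨ +-cong (trans (sym (∑<-+ (suc m) _ _)) (∑<-zero (suc m) (λ k _ → cancel k))) inner≈0 ⟩
    0# + 0#
      ≈⟨ +-identityʳ 0# ⟩
    0# ∎
    where
    T : ℕ → ℕ → Carrier
    T j k = W j (skip j k) * M j k
    inner : ℕ → Carrier
    inner j = sgn j (∑< m (λ k → sgn k (T (suc j) (suc k))))
    peel : ∀ j → - sgn j (∑< (suc m) (λ k → sgn k (T (suc j) k))) ≈ - sgn j (T (suc j) 0) + inner j
    peel j = begin
      - sgn j (∑< (suc m) (λ k → sgn k (T (suc j) k)))
        ≡⟨ cong (λ x → - sgn j x) (∑<-suc m _) ⟩
      - sgn j (T (suc j) 0 + ∑< m (λ k → - sgn k (T (suc j) (suc k))))
        ≈⟨ -‿cong (sgn-+ j _ _) ⟩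
      - (sgn j (T (suc j) 0) + sgn j (∑< m (λ k → - sgn k (T (suc j) (suc k)))))
        ≈⟨ -‿+-comm _ _ ⟨
      - sgn j (T (suc j) 0) + - sgn j (∑< m (λ k → - sgn k (T (suc j) (suc k))))
        ≈⟨ +-congˡ (-‿cong (sgn-cong j (∑<-sgn m 1 _))) ⟨
      - sgn j (T (suc j) 0) + - sgn j (- ∑< m (λ k → sgn k (T (suc j) (suc k))))
        ≈⟨ +-congˡ (trans (-‿cong (sgn-‿ j _)) (-‿involutive _)) ⟩
      - sgn j (T (suc j) 0) + inner j ∎
    cancel : ∀ k → sgn k (T 0 k) + - sgn k (T (suc k) 0) ≈ 0#
    cancel k = begin
      sgn k (T 0 k) + - sgn k (T (suc k) 0)   ≈⟨ +-congˡ (-‿cong (sgn-cong k (*-cong (W-sym _ _) (sym (M-swap 0 k z≤n))))) ⟩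
      sgn k (T 0 k) + - sgn k (T 0 k)         ≈⟨ -‿inverseʳ _ ⟩
      0#                                      ∎
    inner≈0 : ∑< (suc m) inner ≈ 0#
    inner≈0 = alternating-double-sum≈0 m (λ a b → W (suc a) (suc b)) (λ a b → M (suc a) (suc b))
                (λ a b → W-sym (suc a) (suc b)) (λ a b a≤b → M-swap (suc a) (suc b) (s≤s a≤b))

  Det-laplace² : ∀ n A → Det (suc (suc n)) A ≈
    ∑< (suc (suc n)) (λ j → sgn j (∑< (suc n) (λ k →
      sgn k ((A 0 j * A 1 (skip j k)) * Det n (minor k (minor j A))))))
  Det-laplace² n A = begin
    Det (suc (suc n)) A
      ≈⟨ Det-laplace (suc n) A ⟩
    ∑< (suc (suc n)) (λ j → sgn j (A 0 j * Det (suc n) (minor j A)))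
      ≈⟨ ∑<-cong (suc (suc n)) (λ j _ → sgn-cong j (*-congˡ (Det-laplace n (minor j A)))) ⟩
    ∑< (suc (suc n)) (λ j → sgn j (A 0 j * ∑< (suc n) (λ k → sgn k (A 1 (skip j k) * Det n (minor k (minor j A))))))
      ≈⟨ ∑<-cong (suc (suc n)) (λ j _ → sgn-cong j (trans (*-distribˡ-∑< (suc n) _ _)
           (∑<-cong (suc n) (λ k _ → trans (sym (sgn-*ʳ k _ _)) (sgn-cong k (sym (*-assoc _ _ _))))))) ⟩
    ∑< (suc (suc n)) (λ j → sgn j (∑< (suc n) (λ k → sgn k ((A 0 j * A 1 (skip j k)) * Det n (minor k (minor j A)))))) ∎

  Det-minor-minor : ∀ n A {a b} → a ≤ b → Det n (minor b (minor a A)) ≈ Det n (minor a (minor (suc b) A))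
  Det-minor-minor n A a≤b = Det-cong≡ n (λ i l → cong (A (suc (suc i))) (skip-skip l a≤b))

  Det-equalRows₀₁ : ∀ n A → (∀ j → A 0 j ≈ A 1 j) → Det (suc (suc n)) A ≈ 0#
  Det-equalRows₀₁ n A A₀≈A₁ = begin
    Det (suc (suc n)) A
      ≈⟨ Det-laplace² n A ⟩
    ∑< (suc (suc n)) (λ j → sgn j (∑< (suc n) (λ k → sgn k ((A 0 j * A 1 (skip j k)) * Det n (minor k (minor j A))))))
      ≈⟨ ∑<-cong (suc (suc n)) (λ j _ → sgn-cong j (∑<-cong (suc n) (λ k _ →
           sgn-cong k (*-congʳ (*-congˡ (sym (A₀≈A₁ _))))))) ⟩
    ∑< (suc (suc n)) (λ j → sgn j (∑< (suc n) (λ k → sgn k ((A 0 j * A 0 (skip j k)) * Det n (minor k (minor j A))))))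
      ≈⟨ alternating-double-sum≈0 (suc n) (λ a b → A 0 a * A 0 b) (λ a b → Det n (minor b (minor a A)))
           (λ a b → *-comm _ _) (λ a b → Det-minor-minor n A) ⟩
    0# ∎

  Det-swapRows₀₁ : ∀ n A → Det (suc (suc n)) A + Det (suc (suc n)) (rows (swapAdj 0) A) ≈ 0#
  Det-swapRows₀₁ n A = begin
    Det (suc (suc n)) A + Det (suc (suc n)) (rows (swapAdj 0) A)
      ≈⟨ +-cong (Det-laplace² n A) (Det-laplace² n (rows (swapAdj 0) A)) ⟩
    ∑< (suc (suc n)) (λ j → sgn j (∑< (suc n) (λ k → sgn k (T₀₁ j k))))
      + ∑< (suc (suc n)) (λ j → sgn j (∑< (suc n) (λ k → sgn k (T₁₀ j k))))
      ≈⟨ ∑<-+ (suc (suc n)) _ _ ⟨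
    ∑< (suc (suc n)) (λ j → sgn j (∑< (suc n) (λ k → sgn k (T₀₁ j k))) + sgn j (∑< (suc n) (λ k → sgn k (T₁₀ j k))))
      ≈⟨ ∑<-cong (suc (suc n)) (λ j _ → trans (sym (sgn-+ j _ _)) (sgn-cong j (trans (sym (∑<-+ (suc n) _ _))
           (∑<-cong (suc n) (λ k _ → trans (sym (sgn-+ k _ _)) (sgn-cong k (sym (distribʳ _ _ _)))))))) ⟩
    ∑< (suc (suc n)) (λ j → sgn j (∑< (suc n) (λ k → sgn k (W j (skip j k) * Det n (minor k (minor j A))))))
      ≈⟨ alternating-double-sum≈0 (suc n) W (λ a b → Det n (minor b (minor a A)))
           (λ a b → trans (+-comm _ _) (+-cong (*-comm _ _) (*-comm _ _))) (λ a b → Det-minor-minor n A) ⟩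
    0# ∎
    where
    W : ℕ → ℕ → Carrier
    W a b = A 0 a * A 1 b + A 1 a * A 0 b
    T₀₁ T₁₀ : ℕ → ℕ → Carrier
    T₀₁ j k = (A 0 j * A 1 (skip j k)) * Det n (minor k (minor j A))
    T₁₀ j k = (A 1 j * A 0 (skip j k)) * Det n (minor k (minor j A))

  Det-swapRows : ∀ n i A → suc i < n → Det n (rows (swapAdj i) A) ≈ - Det n A
  Det-swapRows (suc zero)    zero    A (s≤s ())
  Det-swapRows (suc (suc n)) zero    A _ = +-inverseʳ-unique _ _ (Det-swapRows₀₁ n A)
  Det-swapRows (suc (suc n)) (suc i) A (s≤s i<n) = begin
    Det (suc (suc n)) (rows (swapAdj (suc i)) A)
      ≈⟨ Det-laplace (suc n) _ ⟩
    ∑< (suc (suc n)) (λ j → sgn j (A 0 j * Det (suc n) (rows (swapAdj i) (minor j A))))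
      ≈⟨ ∑<-cong (suc (suc n)) (λ j _ → sgn-cong j (*-congˡ (Det-swapRows (suc n) i (minor j A) i<n))) ⟩
    ∑< (suc (suc n)) (λ j → sgn j (A 0 j * - Det (suc n) (minor j A)))
      ≈⟨ ∑<-cong (suc (suc n)) (λ j _ → sgn-*-‿ j _ _) ⟩
    ∑< (suc (suc n)) (λ j → - sgn j (A 0 j * Det (suc n) (minor j A)))
      ≈⟨ ∑<-sgn (suc (suc n)) 1 _ ⟨
    - ∑< (suc (suc n)) (λ j → sgn j (A 0 j * Det (suc n) (minor j A)))
      ≈⟨ -‿cong (Det-laplace (suc n) A) ⟨
    - Det (suc (suc n)) A ∎

  Det-equalRows : ∀ n i A → suc i < n → (∀ j → A 0 j ≈ A (suc i) j) → Det n A ≈ 0#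
  Det-equalRows (suc zero)    zero    A (s≤s ()) _
  Det-equalRows (suc (suc n)) zero    A _ A₀≈A₁ = Det-equalRows₀₁ n A A₀≈A₁
  Det-equalRows n             (suc i) A i<n A₀≈A₁ = begin
    Det n A                            ≈⟨ -‿involutive _ ⟨
    - - Det n A                        ≈⟨ -‿cong (Det-swapRows n (suc i) A i<n) ⟨
    - Det n (rows (swapAdj (suc i)) A) ≈⟨ -‿cong (Det-equalRows n i _ (ℕₚ.<-trans (ℕₚ.n<1+n _) i<n)
                                            (λ j → trans (A₀≈A₁ j) (reflexive (cong (λ k → A k j) (≡.sym (swapAdj-self (suc i))))))) ⟩
    - 0#                               ≈⟨ -0#≈0# ⟩
    0#                                 ∎

  Det-rotateRows : ∀ m n A → m < n → Det n (rows (rotate m) A) ≈ sgn m (Det n A)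
  Det-rotateRows zero    n A _   = Det-cong≡ n (λ { zero j → ≡.refl ; (suc i) j → ≡.refl })
  Det-rotateRows (suc m) n A m<n = begin
    Det n (rows (rotate (suc m)) A)              ≈⟨ Det-cong≡ n (λ i j → cong (λ k → A k j) (rotate-suc m i)) ⟩
    Det n (rows (rotate m) (rows (swapAdj m) A)) ≈⟨ Det-rotateRows m n _ (ℕₚ.<-trans (ℕₚ.n<1+n m) m<n) ⟩
    sgn m (Det n (rows (swapAdj m) A))           ≈⟨ sgn-cong m (Det-swapRows n m A m<n) ⟩
    sgn m (- Det n A)                            ≈⟨ sgn-‿ m _ ⟩
    - sgn m (Det n A)                            ∎

  -- Reindexing the Laplace expansion by swapAdj i exchanges the terms i and i + 1 and swaps two
  -- columns of the minors in the other terms.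
  Det-swapCols : ∀ n i A → suc i < n → Det n (cols (swapAdj i) A) ≈ - Det n A
  Det-swapCols (suc n) i A i<n = begin
    Det (suc n) (cols (swapAdj i) A)   ≈⟨ Det-laplace n _ ⟩
    ∑< (suc n) (F i)                   ≈⟨ ∑<-swapAdj (suc n) i (F i) i<n ⟨
    ∑< (suc n) (F i ∘ swapAdj i)       ≈⟨ ∑<-cong (suc n) (term i i<n) ⟩
    ∑< (suc n) (λ j → - G j)           ≈⟨ ∑<-sgn (suc n) 1 G ⟨
    - ∑< (suc n) G                     ≈⟨ -‿cong (Det-laplace n A) ⟨
    - Det (suc n) A                    ∎
    where
    F : ℕ → ℕ → Carrier
    F i j = sgn j (A 0 (swapAdj i j) * Det n (minor j (cols (swapAdj i) A)))
    G : ℕ → Carrier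
    G j = sgn j (A 0 j * Det n (minor j A))
    term : ∀ i → suc i < suc n → ∀ j → j < suc n → F i (swapAdj i j) ≈ - G j
    term i i<n j j<n with position i j
    term (suc i) (s≤s i<n) j j<n | before (s≤s j≤i) = begin
      F (suc i) (swapAdj (suc i) j)
        ≡⟨ cong (F (suc i)) (swapAdj-< (s≤s j≤i)) ⟩
      sgn j (A 0 (swapAdj (suc i) j) * Det n (minor j (cols (swapAdj (suc i)) A)))
        ≈⟨ sgn-cong j (*-cong (reflexive (cong (A 0) (swapAdj-< (s≤s j≤i))))
             (Det-cong≡ n (λ r k → cong (A (suc r)) (swapAdj-skip-≤ k j≤i)))) ⟩
      sgn j (A 0 j * Det n (cols (swapAdj i) (minor j A)))
        ≈⟨ sgn-cong j (*-congˡ (Det-swapCols n i (minor j A) i<n)) ⟩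
      sgn j (A 0 j * - Det n (minor j A))
        ≈⟨ sgn-*-‿ j _ _ ⟩
      - G j ∎
    term i i<n i _ | at = begin
      F i (swapAdj i i)
        ≡⟨ cong (F i) (swapAdj-self i) ⟩
      - sgn i (A 0 (swapAdj i (suc i)) * Det n (minor (suc i) (cols (swapAdj i) A)))
        ≈⟨ -‿cong (sgn-cong i (*-cong (reflexive (cong (A 0) (swapAdj-suc i)))
             (Det-cong≡ n (λ r k → cong (A (suc r)) (swapAdj-skip-suc i k))))) ⟩
      - G i ∎
    term i i<n (suc i) _ | next = begin
      F i (swapAdj i (suc i))
        ≡⟨ cong (F i) (swapAdj-suc i) ⟩
      sgn i (A 0 (swapAdj i i) * Det n (minor i (cols (swapAdj i) A)))
        ≈⟨ sgn-cong i (*-cong (reflexive (cong (A 0) (swapAdj-self i)))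
             (Det-cong≡ n (λ r k → cong (A (suc r)) (swapAdj-skip i k)))) ⟩
      sgn i (A 0 (suc i) * Det n (minor (suc i) A))
        ≈⟨ -‿involutive _ ⟨
      - G (suc i) ∎
    term i i<n j j<n | after i<j = begin
      F i (swapAdj i j)
        ≡⟨ cong (F i) (swapAdj-> i<j) ⟩
      sgn j (A 0 (swapAdj i j) * Det n (minor j (cols (swapAdj i) A)))
        ≈⟨ sgn-cong j (*-cong (reflexive (cong (A 0) (swapAdj-> i<j)))
             (Det-cong≡ n (λ r k → cong (A (suc r)) (swapAdj-skip-> k i<j)))) ⟩
      sgn j (A 0 j * Det n (cols (swapAdj i) (minor j A)))
        ≈⟨ sgn-cong j (*-congˡ (Det-swapCols n i (minor j A) (ℕₚ.<-≤-trans i<j (ℕₚ.≤-pred j<n)))) ⟩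
      sgn j (A 0 j * - Det n (minor j A))
        ≈⟨ sgn-*-‿ j _ _ ⟩
      - G j ∎

  Det-equalCols₀₁ : ∀ n A → 1 < n → (∀ i → A i 0 ≈ A i 1) → Det n A ≈ 0#
  Det-equalCols₀₁ (suc n) A (s≤s 0<n) A₀≈A₁ = begin
    Det (suc n) A                        ≈⟨ Det-laplace n A ⟩
    ∑< (suc n) G                         ≡⟨ ∑<-suc n G ⟩
    G 0 + ∑< n (G ∘ suc)                 ≈⟨ +-congˡ (∑<-head n 0<n tail≈0) ⟩
    G 0 + - (A 0 1 * Det n (minor 1 A))  ≈⟨ +-congˡ (-‿cong (*-cong (sym (A₀≈A₁ 0)) minors≈)) ⟩
    G 0 + - G 0                          ≈⟨ -‿inverseʳ (G 0) ⟩
    0#                                   ∎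
    where
    G : ℕ → Carrier
    G j = sgn j (A 0 j * Det n (minor j A))
    minors≈ : Det n (minor 1 A) ≈ Det n (minor 0 A)
    minors≈ = Det-cong n (λ { i zero _ _ → A₀≈A₁ (suc i) ; i (suc k) _ _ → refl })
    tail≈0 : ∀ j → 0 < j → j < n → G (suc j) ≈ 0#
    tail≈0 (suc j) _ j<n = sgn≈0 (suc (suc j)) (*-≈0ʳ _ (Det-equalCols₀₁ n (minor (suc (suc j)) A)
                             (ℕₚ.≤-<-trans (s≤s z≤n) j<n) (λ i → A₀≈A₁ (suc i))))

  Det-equalCols : ∀ n i A → suc i < n → (∀ r → A r 0 ≈ A r (suc i)) → Det n A ≈ 0#
  Det-equalCols n zero    A i<n A₀≈Aᵢ = Det-equalCols₀₁ n A i<n A₀≈Aᵢ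
  Det-equalCols n (suc i) A i<n A₀≈Aᵢ = begin
    Det n A                            ≈⟨ -‿involutive _ ⟨
    - - Det n A                        ≈⟨ -‿cong (Det-swapCols n (suc i) A i<n) ⟨
    - Det n (cols (swapAdj (suc i)) A) ≈⟨ -‿cong (Det-equalCols n i _ (ℕₚ.<-trans (ℕₚ.n<1+n _) i<n)
                                          (λ r → trans (A₀≈Aᵢ r) (reflexive (cong (A r) (≡.sym (swapAdj-self (suc i))))))) ⟩
    - 0#                               ≈⟨ -0#≈0# ⟩
    0#                                 ∎

  Det-rotateCols : ∀ m n A → m < n → Det n (cols (rotate m) A) ≈ sgn m (Det n A)
  Det-rotateCols zero    n A _   = Det-cong≡ n (λ { i zero → ≡.refl ; i (suc j) → ≡.refl })
  Det-rotateCols (suc m) n A m<n = begin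
    Det n (cols (rotate (suc m)) A)              ≈⟨ Det-cong≡ n (λ i j → cong (A i) (rotate-suc m j)) ⟩
    Det n (cols (rotate m) (cols (swapAdj m) A)) ≈⟨ Det-rotateCols m n _ (ℕₚ.<-trans (ℕₚ.n<1+n m) m<n) ⟩
    sgn m (Det n (cols (swapAdj m) A))           ≈⟨ sgn-cong m (Det-swapCols n m A m<n) ⟩
    sgn m (- Det n A)                            ≈⟨ sgn-‿ m _ ⟩
    - sgn m (Det n A)                            ∎

  setRow₀ : (ℕ → Carrier) → Matrix → Matrix
  setRow₀ v A zero    j = v j
  setRow₀ v A (suc i) j = A (suc i) j

  setCol₀ : (ℕ → Carrier) → Matrix → Matrix
  setCol₀ v A i zero    = v i
  setCol₀ v A i (suc j) = A i (suc j)

  Det-linear-row₀ : ∀ n m (a : ℕ → Carrier) (W : ℕ → ℕ → Carrier) A →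
    (∀ j → j < suc n → A 0 j ≈ ∑< m (λ k → a k * W k j)) →
    Det (suc n) A ≈ ∑< m (λ k → a k * Det (suc n) (setRow₀ (W k) A))
  Det-linear-row₀ n m a W A A₀≈ = begin
    Det (suc n) A
      ≈⟨ Det-laplace n A ⟩
    ∑< (suc n) (λ j → sgn j (A 0 j * Det n (minor j A)))
      ≈⟨ ∑<-linear (suc n) m a (λ k j → sgn j (W k j * Det n (minor j A))) (λ j j<n →
           trans (sgn-cong j (*-congʳ (A₀≈ j j<n))) (sgn-∑<-* m j _ a (λ k → W k j))) ⟩
    ∑< m (λ k → a k * ∑< (suc n) (λ j → sgn j (W k j * Det n (minor j A))))
      ≈⟨ ∑<-cong m (λ k _ → *-congˡ (Det-laplace n (setRow₀ (W k) A))) ⟨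
    ∑< m (λ k → a k * Det (suc n) (setRow₀ (W k) A)) ∎

  Det-linear-col₀ : ∀ {n} m (a : ℕ → Carrier) (V : ℕ → ℕ → Carrier) A → 0 < n →
    (∀ i → i < n → A i 0 ≈ ∑< m (λ k → a k * V k i)) →
    Det n A ≈ ∑< m (λ k → a k * Det n (setCol₀ (V k) A))
  Det-linear-col₀ {suc n} m a V A _ A₀≈ = begin
    Det (suc n) A
      ≈⟨ Det-laplace n A ⟩
    ∑< (suc n) (λ j → sgn j (A 0 j * Det n (minor j A)))
      ≈⟨ ∑<-linear (suc n) m a (λ k j → sgn j (B k 0 j * Det n (minor j (B k)))) term ⟩
    ∑< m (λ k → a k * ∑< (suc n) (λ j → sgn j (B k 0 j * Det n (minor j (B k)))))
      ≈⟨ ∑<-cong m (λ k _ → *-congˡ (Det-laplace n (B k))) ⟨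
    ∑< m (λ k → a k * Det (suc n) (B k)) ∎
    where
    B : ℕ → Matrix
    B k = setCol₀ (V k) A
    term : ∀ j → j < suc n →
           sgn j (A 0 j * Det n (minor j A)) ≈ ∑< m (λ k → a k * sgn j (B k 0 j * Det n (minor j (B k))))
    term zero _ = begin
      A 0 0 * Det n (minor 0 A)                          ≈⟨ *-congʳ (A₀≈ 0 (s≤s z≤n)) ⟩
      ∑< m (λ k → a k * V k 0) * Det n (minor 0 A)       ≈⟨ *-distribʳ-∑< m _ _ ⟩
      ∑< m (λ k → (a k * V k 0) * Det n (minor 0 A))     ≈⟨ ∑<-cong m (λ k _ → *-assoc _ _ _) ⟩
      ∑< m (λ k → a k * (V k 0 * Det n (minor 0 (B k)))) ∎
    term (suc j) (s≤s j<n) = begin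
      sgn (suc j) (A 0 (suc j) * Det n (minor (suc j) A))
        ≈⟨ sgn-cong (suc j) (*-congˡ (Det-linear-col₀ m a (λ k → V k ∘ suc) (minor (suc j) A)
             (ℕₚ.≤-<-trans z≤n j<n) (λ i i<n → A₀≈ (suc i) (s≤s i<n)))) ⟩
      sgn (suc j) (A 0 (suc j) * ∑< m (λ k → a k * Det n (setCol₀ (V k ∘ suc) (minor (suc j) A))))
        ≈⟨ sgn-*-∑< m (suc j) _ a _ ⟩
      ∑< m (λ k → a k * sgn (suc j) (A 0 (suc j) * Det n (setCol₀ (V k ∘ suc) (minor (suc j) A))))
        ≈⟨ ∑<-cong m (λ k _ → *-congˡ (sgn-cong (suc j) (*-congˡ
             (Det-cong≡ n (λ { i zero → ≡.refl ; i (suc c) → ≡.refl }))))) ⟩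
      ∑< m (λ k → a k * sgn (suc j) (B k 0 (suc j) * Det n (minor (suc j) (B k)))) ∎

  unit : ℕ → ℕ → Carrier
  unit zero    zero    = 1#
  unit zero    (suc r) = 0#
  unit (suc k) zero    = 0#
  unit (suc k) (suc r) = unit k r

  ∑<-unit : ∀ m (x : ℕ → Carrier) r → r < m → ∑< m (λ i → x i * unit i r) ≈ x r
  ∑<-unit (suc m) x zero    _ = begin
    ∑< (suc m) (λ i → x i * unit i 0)          ≡⟨ ∑<-suc m _ ⟩
    x 0 * 1# + ∑< m (λ i → x (suc i) * 0#)     ≈⟨ +-cong (*-identityʳ _) (∑<-zero m (λ i _ → zeroʳ _)) ⟩
    x 0 + 0#                                   ≈⟨ +-identityʳ _ ⟩
    x 0                                        ∎
  ∑<-unit (suc m) x (suc r) (s≤s r<m) = begin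
    ∑< (suc m) (λ i → x i * unit i (suc r))        ≡⟨ ∑<-suc m _ ⟩
    x 0 * 0# + ∑< m (λ i → x (suc i) * unit i r)   ≈⟨ +-cong (zeroʳ _) (∑<-unit m (x ∘ suc) r r<m) ⟩
    0# + x (suc r)                                 ≈⟨ +-identityˡ _ ⟩
    x (suc r)                                      ∎

  Det-unitCol₀ : ∀ n A → Det (suc n) (setCol₀ (unit n) A) ≈ sgn n (Det n (cols suc A))
  Det-unitCol₀ zero A = begin
    Det 1 (setCol₀ (unit 0) A)                       ≈⟨ Det-laplace 0 _ ⟩
    ∑< 1 (λ j → sgn j (setCol₀ (unit 0) A 0 j * Det 0 (minor j (setCol₀ (unit 0) A))))
                                                     ≡⟨ ∑<-suc 0 _ ⟩
    1# * Det 0 (minor 0 (setCol₀ (unit 0) A)) + ∑< 0 _ ≈⟨ +-cong (*-identityˡ _) (reflexive (∑<-empty _)) ⟩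
    Det 0 (minor 0 (setCol₀ (unit 0) A)) + 0#        ≈⟨ +-identityʳ _ ⟩
    Det 0 (minor 0 (setCol₀ (unit 0) A))             ≈⟨ Det-zero _ ⟩
    1#                                               ≈⟨ Det-zero _ ⟨
    Det 0 (cols suc A)                               ∎
  Det-unitCol₀ (suc n) A = begin
    Det (suc (suc n)) B                              ≈⟨ Det-laplace (suc n) B ⟩
    ∑< (suc (suc n)) G                               ≡⟨ ∑<-suc (suc n) G ⟩
    0# * Det (suc n) (minor 0 B) + ∑< (suc n) (G ∘ suc)
                                                     ≈⟨ +-cong (zeroˡ _) (∑<-cong (suc n) (λ j _ → -‿cong (term j))) ⟩
    0# + ∑< (suc n) (λ j → - sgn n (H j))            ≈⟨ +-identityˡ _ ⟩
    ∑< (suc n) (λ j → sgn (suc n) (H j))             ≈⟨ ∑<-sgn (suc n) (suc n) H ⟨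
    sgn (suc n) (∑< (suc n) H)                       ≈⟨ sgn-cong (suc n) (Det-laplace n (cols suc A)) ⟨
    sgn (suc n) (Det (suc n) (cols suc A))           ∎
    where
    B : Matrix
    B = setCol₀ (unit (suc n)) A
    G : ℕ → Carrier
    G j = sgn j (B 0 j * Det (suc n) (minor j B))
    H : ℕ → Carrier
    H j = sgn j (A 0 (suc j) * Det n (minor j (cols suc A)))
    term : ∀ j → sgn j (A 0 (suc j) * Det (suc n) (minor (suc j) B)) ≈ sgn n (H j)
    term j = begin
      sgn j (A 0 (suc j) * Det (suc n) (minor (suc j) B))
        ≈⟨ sgn-cong j (*-congˡ (Det-cong≡ (suc n) (λ { i zero → ≡.refl ; i (suc c) → ≡.refl }))) ⟩
      sgn j (A 0 (suc j) * Det (suc n) (setCol₀ (unit n) (minor (suc j) A)))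
        ≈⟨ sgn-cong j (*-congˡ (Det-unitCol₀ n (minor (suc j) A))) ⟩
      sgn j (A 0 (suc j) * sgn n (Det n (minor j (cols suc A))))
        ≈⟨ sgn-cong j (sgn-*ʳ n _ _) ⟨
      sgn j (sgn n (A 0 (suc j) * Det n (minor j (cols suc A))))
        ≈⟨ sgn-comm j n _ ⟩
      sgn n (H j) ∎

  -- A Plücker relation between minors on the first n and n + 1 rows

  Δ : Matrix → ℕ → (ℕ → ℕ) → Carrier
  Δ E m κ = Det m (cols κ E)

  Δ-cong : ∀ E m {κ κ′ : ℕ → ℕ} → (∀ {j} → j < m → κ j ≡ κ′ j) → Δ E m κ ≈ Δ E m κ′
  Δ-cong E m κ≡κ′ = Det-cong m (λ i j _ j<m → reflexive (cong (E i) (κ≡κ′ j<m)))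

  -- Expanding g k = Δ E (n + 1) (cons k ι) along its first column gives g k = ∑ C i · E i k. So the
  -- left-hand side, the Laplace expansion of P with first row g ∘ κ, is ∑ C i times determinants
  -- whose first row E i ∘ κ repeats their row i + 1, unless i = n.
  plücker : ∀ E n (κ ι : ℕ → ℕ) →
    ∑< (suc n) (λ j → sgn j (Δ E (suc n) (cons (κ j) ι) * Δ E n (κ ∘ skip j))) ≈ Δ E n ι * Δ E (suc n) κ
  plücker E n κ ι = begin
    ∑< (suc n) (λ j → sgn j (g (κ j) * Δ E n (κ ∘ skip j)))
      ≈⟨ Det-laplace n P ⟨
    Det (suc n) P
      ≈⟨ Det-linear-row₀ n (suc n) C (λ i → E i ∘ κ) P (λ a _ → g≈ (κ a)) ⟩
    ∑< (suc n) (λ i → C i * Det (suc n) (setRow₀ (E i ∘ κ) P))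
      ≈⟨ ∑<-last n _ ⟩
    ∑< n (λ i → C i * Det (suc n) (setRow₀ (E i ∘ κ) P)) + C n * Det (suc n) (setRow₀ (E n ∘ κ) P)
      ≈⟨ +-cong (∑<-zero n (λ i i<n → *-≈0ʳ (C i) (Det-equalRows (suc n) i _ (s≤s i<n) (λ _ → refl))))
                (*-cong (Det-unitCol₀ n _) lastRow) ⟩
    0# + sgn n (Δ E n ι) * sgn n (Δ E (suc n) κ)
      ≈⟨ +-identityˡ _ ⟩
    sgn n (Δ E n ι) * sgn n (Δ E (suc n) κ)
      ≈⟨ sgn-*-sgn n _ _ ⟩
    Δ E n ι * Δ E (suc n) κ ∎
    where
    g : ℕ → Carrier
    g k = Δ E (suc n) (cons k ι)
    C : ℕ → Carrier
    C i = Det (suc n) (setCol₀ (unit i) (cols (cons 0 ι) E))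
    g≈ : ∀ k → g k ≈ ∑< (suc n) (λ i → C i * E i k)
    g≈ k = begin
      g k
        ≈⟨ Det-linear-col₀ (suc n) (λ i → E i k) unit _ (s≤s z≤n)
             (λ r r<n → sym (∑<-unit (suc n) (λ i → E i k) r r<n)) ⟩
      ∑< (suc n) (λ i → E i k * Det (suc n) (setCol₀ (unit i) (cols (cons k ι) E)))
        ≈⟨ ∑<-cong (suc n) (λ i _ → trans (*-comm _ _)
             (*-congʳ (Det-cong≡ (suc n) (λ { r zero → ≡.refl ; r (suc c) → ≡.refl })))) ⟩
      ∑< (suc n) (λ i → C i * E i k) ∎
    P : Matrix
    P zero    a = g (κ a)
    P (suc i) a = E i (κ a)
    lastRow : Det (suc n) (setRow₀ (E n ∘ κ) P) ≈ sgn n (Δ E (suc n) κ)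
    lastRow = begin
      Det (suc n) (setRow₀ (E n ∘ κ) P)
        ≈⟨ Det-cong (suc n) (λ { zero a _ _ → refl
                               ; (suc r) a (s≤s r<n) _ → reflexive (cong (λ t → E t (κ a)) (≡.sym (skip-< r<n))) }) ⟩
      Det (suc n) (rows (rotate n) (cols κ E))
        ≈⟨ Det-rotateRows n (suc n) (cols κ E) (ℕₚ.n<1+n n) ⟩
      sgn n (Δ E (suc n) κ) ∎

-- Partitions [ p | q ]^l_k and the columns of their minors

module Partitions where

  open import Data.Nat using (_+_)

  boxParts : ℕ → ℕ → ℕ → ℕ → List ℕ
  boxParts l d q k = replicate l (suc q) ++ replicate d q ++ k ∷ []

  ≤ᵇ-true : ∀ {m n} → m ≤ n → (m ℕ.≤ᵇ n) ≡ true
  ≤ᵇ-true m≤n = Equivalence.to T-≡ (ℕₚ.≤⇒≤ᵇ m≤n)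

  box≡boxParts : ∀ {p q l k} d → p ≡ d + l → box p q l k ≡ just (boxParts l d q k)
  box≡boxParts {l = l} d ≡.refl rewrite ≤ᵇ-true (ℕₚ.m≤n+m l d) | ℕₚ.m+n∸n≡m d l = ≡.refl

  box-undefined : ∀ {p q l k} → p < l → box p q l k ≡ nothing
  box-undefined {p} {l = l} p<l with l ℕ.≤ᵇ p in l≤ᵇp
  ... | false = ≡.refl
  ... | true  = contradiction (ℕₚ.≤ᵇ⇒≤ l p (Equivalence.from T-≡ l≤ᵇp)) (ℕₚ.<⇒≱ p<l)

  part-replicate-++ˡ : ∀ {l i} x ys → i < l → part (replicate l x ++ ys) i ≡ x
  part-replicate-++ˡ {suc l} {zero}  x ys _         = ≡.refl
  part-replicate-++ˡ {suc l} {suc i} x ys (s≤s i<l) = part-replicate-++ˡ x ys i<l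

  part-replicate-++ʳ : ∀ l x ys i → part (replicate l x ++ ys) (l + i) ≡ part ys i
  part-replicate-++ʳ zero    x ys i = ≡.refl
  part-replicate-++ʳ (suc l) x ys i = part-replicate-++ʳ l x ys i

  module _ (l d q k : ℕ) where

    boxParts-top : ∀ {i} → i < l → part (boxParts l d q k) i ≡ suc q
    boxParts-top = part-replicate-++ˡ (suc q) _

    boxParts-mid : ∀ {i} → i < d → part (boxParts l d q k) (l + i) ≡ q
    boxParts-mid {i} i<d = ≡.trans (part-replicate-++ʳ l (suc q) _ i) (part-replicate-++ˡ q _ i<d)

    boxParts-last : part (boxParts l d q k) (l + d) ≡ k
    boxParts-last = begin
      part (boxParts l d q k) (l + d)                  ≡⟨ part-replicate-++ʳ l (suc q) _ d ⟩
      part (replicate d q ++ k ∷ []) d                 ≡⟨ cong (part (replicate d q ++ k ∷ [])) (ℕₚ.+-identityʳ d) ⟨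
      part (replicate d q ++ k ∷ []) (d + 0)           ≡⟨ part-replicate-++ʳ d q (k ∷ []) 0 ⟩
      k                                                ∎
      where open ≡.≡-Reasoning

    boxParts-beyond : ∀ e → part (boxParts l d q k) (l + (d + suc e)) ≡ 0
    boxParts-beyond e = ≡.trans (part-replicate-++ʳ l (suc q) _ (d + suc e)) (part-replicate-++ʳ d q (k ∷ []) (suc e))

  boxParts₀-beyond : ∀ l d q e → part (boxParts l d q 0) (l + (d + e)) ≡ 0
  boxParts₀-beyond l d q zero    =
    ≡.trans (cong (λ i → part (boxParts l d q 0) (l + i)) (ℕₚ.+-identityʳ d)) (boxParts-last l d q 0)
  boxParts₀-beyond l d q (suc e) = boxParts-beyond l d q 0 e

  nonincr-replicate-++ : ∀ l x ys → nonincr ys ≡ true → part ys 0 ≤ x → nonincr (replicate l x ++ ys) ≡ true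
  nonincr-replicate-++ zero          x ys       ys↓ _   = ys↓
  nonincr-replicate-++ (suc zero)    x []       _   _   = ≡.refl
  nonincr-replicate-++ (suc zero)    x (y ∷ ys) ys↓ y≤x = ≡.cong₂ _∧_ (≤ᵇ-true y≤x) ys↓
  nonincr-replicate-++ (suc (suc l)) x ys       ys↓ y≤x =
    ≡.cong₂ _∧_ (≤ᵇ-true (ℕₚ.≤-refl {x})) (nonincr-replicate-++ (suc l) x ys ys↓ y≤x)

  boxParts₀-head≤ : ∀ d {q k} → k ≤ q → part (boxParts 0 d q k) 0 ≤ q
  boxParts₀-head≤ zero    k≤q = k≤q
  boxParts₀-head≤ (suc d) k≤q = ℕₚ.≤-refl

  boxParts-head≤ : ∀ l d {q k} → k ≤ q → part (boxParts l d q k) 0 ≤ suc q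
  boxParts-head≤ zero    d k≤q = ℕₚ.m≤n⇒m≤1+n (boxParts₀-head≤ d k≤q)
  boxParts-head≤ (suc l) d k≤q = ℕₚ.≤-refl

  boxParts-nonincr : ∀ l d {q k} → k ≤ q → nonincr (boxParts l d q k) ≡ true
  boxParts-nonincr l d {q} {k} k≤q =
    nonincr-replicate-++ l (suc q) _ (nonincr-replicate-++ d q (k ∷ []) ≡.refl k≤q)
      (ℕₚ.m≤n⇒m≤1+n (boxParts₀-head≤ d k≤q))

  columns : ℕ → List ℕ → ℕ → ℕ
  columns r L x = part L (r ∸ suc x) + x

  columns-at : ∀ {r} L x i → r ≡ suc (x + i) → columns r L x ≡ part L i + x
  columns-at L x i ≡.refl = cong (λ j → part L j + x) (ℕₚ.m+n∸m≡n x i)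

  -- columnsU: the symbol [d + l | q]^l on c + d + l rows; columnsL: [d | q]_k on c + d + 1 rows.
  columnsU-below : ∀ {r c} l d q {x} → r ≡ c + (d + l) → x < c → columns r (boxParts l d q 0) x ≡ x
  columnsU-below l d q {x} ≡.refl x<c with ℕₚ.m≤n⇒∃[o]m+o≡n x<c
  ... | e , ≡.refl = ≡.trans (columns-at (boxParts l d q 0) x _ (shape x e d l))
                             (cong (_+ x) (boxParts₀-beyond l d q e))
    where
    shape : ∀ x e d l → suc (x + e) + (d + l) ≡ suc (x + (l + (d + e)))
    shape = solve 4 (λ x e d l → (con 1 :+ (x :+ e)) :+ (d :+ l) := con 1 :+ (x :+ (l :+ (d :+ e)))) ≡.refl

  columnsU-mid : ∀ {r c} l d q {z} → r ≡ c + (d + l) → z < d → columns r (boxParts l d q 0) (c + z) ≡ q + (c + z)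
  columnsU-mid {c = c} l d q {z} ≡.refl z<d with ℕₚ.m≤n⇒∃[o]m+o≡n z<d
  ... | e , ≡.refl = ≡.trans (columns-at (boxParts l d q 0) (c + z) _ (shape c z e l))
                             (cong (_+ (c + z)) (boxParts-mid l d q 0 (s≤s (ℕₚ.m≤n+m e z))))
    where
    shape : ∀ c z e l → c + (suc (z + e) + l) ≡ suc (c + z + (l + e))
    shape = solve 4 (λ c z e l → c :+ ((con 1 :+ (z :+ e)) :+ l) := con 1 :+ ((c :+ z) :+ (l :+ e))) ≡.refl

  columnsU-top : ∀ {r c} l d q {z} → r ≡ c + (d + l) → z < l →
                 columns r (boxParts l d q 0) (c + (d + z)) ≡ suc q + (c + (d + z))
  columnsU-top {c = c} l d q {z} ≡.refl z<l with ℕₚ.m≤n⇒∃[o]m+o≡n z<l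
  ... | e , ≡.refl = ≡.trans (columns-at (boxParts l d q 0) (c + (d + z)) e (shape c d z e))
                             (cong (_+ (c + (d + z))) (boxParts-top l d q 0 (s≤s (ℕₚ.m≤n+m e z))))
    where
    shape : ∀ c d z e → c + (d + suc (z + e)) ≡ suc (c + (d + z) + e)
    shape = solve 4 (λ c d z e → c :+ (d :+ (con 1 :+ (z :+ e))) := con 1 :+ ((c :+ (d :+ z)) :+ e)) ≡.refl

  columnsL-below : ∀ {r c} d q k {x} → r ≡ suc (c + d) → x < c → columns r (boxParts 0 d q k) x ≡ x
  columnsL-below d q k {x} ≡.refl x<c with ℕₚ.m≤n⇒∃[o]m+o≡n x<c
  ... | e , ≡.refl = ≡.trans (columns-at (boxParts 0 d q k) x (d + suc e) (cong suc (shape x e d)))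
                             (cong (_+ x) (boxParts-beyond 0 d q k e))
    where
    shape : ∀ x e d → suc (x + e) + d ≡ x + (d + suc e)
    shape = solve 3 (λ x e d → (con 1 :+ (x :+ e)) :+ d := x :+ (d :+ (con 1 :+ e))) ≡.refl

  columnsL-corner : ∀ {r c} d q k → r ≡ suc (c + d) → columns r (boxParts 0 d q k) c ≡ k + c
  columnsL-corner {c = c} d q k r≡ = ≡.trans (columns-at (boxParts 0 d q k) c d r≡) (cong (_+ c) (boxParts-last 0 d q k))

  columnsL-mid : ∀ {r c} d q k {z} → r ≡ suc (c + d) → z < d → columns r (boxParts 0 d q k) (suc (c + z)) ≡ q + suc (c + z)
  columnsL-mid {c = c} d q k {z} ≡.refl z<d with ℕₚ.m≤n⇒∃[o]m+o≡n z<d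
  ... | e , ≡.refl = ≡.trans (columns-at (boxParts 0 d q k) (suc (c + z)) e (cong suc (shape c z e)))
                             (cong (_+ suc (c + z)) (boxParts-mid 0 d q k (s≤s (ℕₚ.m≤n+m e z))))
    where
    shape : ∀ c z e → c + suc (z + e) ≡ suc (c + z + e)
    shape = solve 3 (λ c z e → c :+ (con 1 :+ (z :+ e)) := con 1 :+ ((c :+ z) :+ e)) ≡.refl

  data Split (c : ℕ) : ℕ → Set where
    below : ∀ {y} → y < c → Split c y
    above : ∀ z → Split c (c + z)

  split : ∀ c y → Split c y
  split zero    y       = above y
  split (suc c) zero    = below (s≤s z≤n)
  split (suc c) (suc y) with split c y
  ... | below y<c = below (s≤s y<c)
  ... | above z   = above z

  1+t+[p∸t∸1]≡p : ∀ {t p} → t < p → suc (t + (p ∸ t ∸ 1)) ≡ p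
  1+t+[p∸t∸1]≡p {zero}  (s≤s _)   = ≡.refl
  1+t+[p∸t∸1]≡p {suc t} (s≤s t<p) = cong suc (1+t+[p∸t∸1]≡p t<p)

  -- With w = q - a and s = a + b - 1: the columns of [p | w], [p | w+s], [p+1 | w+s] and
  -- [p | w+s]_{w+t+1} on r = c + p + 1 rows (κ, μ, Y, ν t), and of [p | w+s+1], [p | w+1] and
  -- [p-1 | w]^{p-t-1} on n = c + p rows (ι, ρ, ω t).
  module RectangleColumns (c w p s : ℕ) where

    n r : ℕ
    n = c + p
    r = suc n

    κ ι μ ρ Y : ℕ → ℕ
    κ = columns r (boxParts 0 p w 0)
    ι = columns n (boxParts 0 p (suc (w + s)) 0)
    μ = columns r (boxParts 0 p (w + s) 0)
    ρ = columns n (boxParts 0 p (suc w) 0)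
    Y = columns r (boxParts 0 (suc p) (w + s) 0)

    ν ω : ℕ → ℕ → ℕ
    ν t = columns r (boxParts 0 p (w + s) (w + t + 1))
    ω t = columns n (boxParts (p ∸ t ∸ 1) t w 0)

    r≡ : r ≡ suc c + (p + 0)
    r≡ = cong (λ i → suc (c + i)) (≡.sym (ℕₚ.+-identityʳ p))

    n≡ : n ≡ c + (p + 0)
    n≡ = cong (c +_) (≡.sym (ℕₚ.+-identityʳ p))

    rY≡ : r ≡ c + (suc p + 0)
    rY≡ = ≡.trans (≡.sym (ℕₚ.+-suc c p)) (cong (c +_) (≡.sym (ℕₚ.+-identityʳ (suc p))))

    nω≡ : ∀ {t} → t < p → n ≡ suc c + (t + (p ∸ t ∸ 1))
    nω≡ t<p = ≡.trans (cong (c +_) (≡.sym (1+t+[p∸t∸1]≡p t<p))) (ℕₚ.+-suc c _)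

    κ-below : ∀ {y} → y < suc c → κ y ≡ y
    κ-below = columnsU-below 0 p w r≡

    κ-above : ∀ {z} → z < p → κ (suc c + z) ≡ w + (suc c + z)
    κ-above = columnsU-mid 0 p w r≡

    ι-below : ∀ {y} → y < c → ι y ≡ y
    ι-below = columnsU-below 0 p (suc (w + s)) n≡

    ι-above : ∀ {z} → z < p → ι (c + z) ≡ suc (w + s) + (c + z)
    ι-above = columnsU-mid 0 p (suc (w + s)) n≡

    μ-below : ∀ {y} → y < suc c → μ y ≡ y
    μ-below = columnsU-below 0 p (w + s) r≡

    μ-above : ∀ {z} → z < p → μ (suc c + z) ≡ (w + s) + (suc c + z)
    μ-above = columnsU-mid 0 p (w + s) r≡

    ρ-below : ∀ {y} → y < c → ρ y ≡ y
    ρ-below = columnsU-below 0 p (suc w) n≡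

    ρ-above : ∀ {z} → z < p → ρ (c + z) ≡ suc w + (c + z)
    ρ-above = columnsU-mid 0 p (suc w) n≡

    Y-below : ∀ {y} → y < c → Y y ≡ y
    Y-below = columnsU-below 0 (suc p) (w + s) rY≡

    Y-above : ∀ {z} → z < suc p → Y (c + z) ≡ (w + s) + (c + z)
    Y-above = columnsU-mid 0 (suc p) (w + s) rY≡

    ν-below : ∀ t {y} → y < c → ν t y ≡ y
    ν-below t = columnsL-below p (w + s) (w + t + 1) ≡.refl

    ν-corner : ∀ t → ν t c ≡ (w + t + 1) + c
    ν-corner t = columnsL-corner p (w + s) (w + t + 1) ≡.refl

    ν-above : ∀ t {z} → z < p → ν t (suc (c + z)) ≡ (w + s) + suc (c + z)
    ν-above t = columnsL-mid p (w + s) (w + t + 1) ≡.refl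

    ω-below : ∀ {t} → t < p → ∀ {y} → y < suc c → ω t y ≡ y
    ω-below {t} t<p = columnsU-below (p ∸ t ∸ 1) t w (nω≡ t<p)

    ω-mid : ∀ {t} → t < p → ∀ {z} → z < t → ω t (suc c + z) ≡ w + (suc c + z)
    ω-mid {t} t<p = columnsU-mid (p ∸ t ∸ 1) t w (nω≡ t<p)

    ω-top : ∀ {t} → t < p → ∀ {z} → z < p ∸ t ∸ 1 → ω t (suc c + (t + z)) ≡ suc w + (suc c + (t + z))
    ω-top {t} t<p = columnsU-top {c = suc c} (p ∸ t ∸ 1) t w (nω≡ t<p)

    cancel<p : ∀ {z} → c + z < n → z < p
    cancel<p {z} = ℕₚ.+-cancelˡ-< c z p

    κ≡ι-below : ∀ {j} → j < c → κ j ≡ ι j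
    κ≡ι-below j<c = ≡.trans (κ-below (ℕₚ.m<n⇒m<1+n j<c)) (≡.sym (ι-below j<c))

    κ≡ι-above : ∀ {i} → s + i < p → κ (suc c + (s + i)) ≡ ι (c + i)
    κ≡ι-above {i} s+i<p = ≡.trans (κ-above s+i<p) (≡.trans (shape w c s i) (≡.sym (ι-above i<p)))
      where
      i<p : i < p
      i<p = ℕₚ.≤-<-trans (ℕₚ.m≤n+m i s) s+i<p
      shape : ∀ w c s i → w + (suc c + (s + i)) ≡ suc (w + s) + (c + i)
      shape = solve 4 (λ w c s i → w :+ ((con 1 :+ c) :+ (s :+ i)) := (con 1 :+ (w :+ s)) :+ (c :+ i)) ≡.refl

    ι≡∘skip : ∀ f → (∀ {y} → y < c → f y ≡ y) → (∀ {z} → z < p → f (suc (c + z)) ≡ (w + s) + suc (c + z)) →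
              ∀ {y} → y < n → ι y ≡ f (skip c y)
    ι≡∘skip f f-below f-above {y} y<n with split c y
    ... | below y<c = ≡.trans (ι-below y<c) (≡.sym (≡.trans (cong f (skip-< y<c)) (f-below y<c)))
    ... | above z   = begin
      ι (c + z)                ≡⟨ ι-above (cancel<p y<n) ⟩
      suc (w + s) + (c + z)    ≡⟨ ℕₚ.+-suc (w + s) (c + z) ⟨
      (w + s) + suc (c + z)    ≡⟨ f-above (cancel<p y<n) ⟨
      f (suc (c + z))          ≡⟨ cong f (skip-≥ (ℕₚ.m≤m+n c z)) ⟨
      f (skip c (c + z))       ∎
      where open ≡.≡-Reasoning

    cons-κ-ι≡μ∘rotate : ∀ {y} → y < r → cons (κ c) ι y ≡ μ (rotate c y)
    cons-κ-ι≡μ∘rotate {zero}  _         = ≡.trans (κ-below (ℕₚ.n<1+n c)) (≡.sym (μ-below (ℕₚ.n<1+n c)))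
    cons-κ-ι≡μ∘rotate {suc y} (s≤s y<n) = ι≡∘skip μ (μ-below ∘ ℕₚ.m<n⇒m<1+n) μ-above y<n

    cons-κ-ι≡ν∘rotate : ∀ {t y} → t < p → y < r → cons (κ (suc c + t)) ι y ≡ ν t (rotate c y)
    cons-κ-ι≡ν∘rotate {t} {zero}  t<p _         =
      ≡.trans (κ-above t<p) (≡.trans (shape w c t) (≡.sym (ν-corner t)))
      where
      shape : ∀ w c t → w + (suc c + t) ≡ (w + t + 1) + c
      shape = solve 3 (λ w c t → w :+ ((con 1 :+ c) :+ t) := ((w :+ t) :+ con 1) :+ c) ≡.refl
    cons-κ-ι≡ν∘rotate {t} {suc y} t<p (s≤s y<n) = ι≡∘skip (ν t) (ν-below t) (ν-above t) y<n

    κ∘skip≡ρ : ∀ {y} → y < n → κ (skip c y) ≡ ρ y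
    κ∘skip≡ρ {y} y<n with split c y
    ... | below y<c = ≡.trans (cong κ (skip-< y<c)) (≡.trans (κ-below (ℕₚ.m<n⇒m<1+n y<c)) (≡.sym (ρ-below y<c)))
    ... | above z   = begin
      κ (skip c (c + z))     ≡⟨ cong κ (skip-≥ (ℕₚ.m≤m+n c z)) ⟩
      κ (suc c + z)          ≡⟨ κ-above (cancel<p y<n) ⟩
      w + suc (c + z)        ≡⟨ ℕₚ.+-suc w (c + z) ⟩
      suc w + (c + z)        ≡⟨ ρ-above (cancel<p y<n) ⟨
      ρ (c + z)              ∎
      where open ≡.≡-Reasoning

    κ∘skip≡ω : ∀ {t y} → t < p → y < n → κ (skip (suc c + t) y) ≡ ω t y
    κ∘skip≡ω {t} {y} t<p y<n with split (suc c) y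
    ... | below y<c = ≡.trans (cong κ (skip-< (ℕₚ.<-≤-trans y<c (ℕₚ.m≤m+n (suc c) t))))
                        (≡.trans (κ-below y<c) (≡.sym (ω-below t<p y<c)))
    ... | above z′ with split t z′
    ...   | below z′<t = begin
      κ (skip (suc c + t) (suc c + z′))  ≡⟨ cong κ (skip-< (ℕₚ.+-monoʳ-< (suc c) z′<t)) ⟩
      κ (suc c + z′)                     ≡⟨ κ-above (ℕₚ.<-trans z′<t t<p) ⟩
      w + (suc c + z′)                   ≡⟨ ω-mid t<p z′<t ⟨
      ω t (suc c + z′)                   ∎
      where open ≡.≡-Reasoning
    ...   | above z    = begin
      κ (skip (suc c + t) (suc c + (t + z)))  ≡⟨ cong κ (≡.trans (skip-≥ (ℕₚ.+-monoʳ-≤ (suc c) (ℕₚ.m≤m+n t z)))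
                                                  (≡.sym (ℕₚ.+-suc (suc c) (t + z)))) ⟩
      κ (suc c + suc (t + z))                 ≡⟨ κ-above 1+t+z<p ⟩
      w + (suc c + suc (t + z))               ≡⟨ shape w c t z ⟩
      suc w + (suc c + (t + z))               ≡⟨ ω-top t<p z<l ⟨
      ω t (suc c + (t + z))                   ∎
      where
      open ≡.≡-Reasoning
      1+t+z<p : suc (t + z) < p
      1+t+z<p = ℕₚ.+-cancelˡ-< c _ p (≡.subst (_< c + p) (≡.sym (ℕₚ.+-suc c (t + z))) y<n)
      z<l : z < p ∸ t ∸ 1
      z<l = ℕₚ.+-cancelˡ-< t z _ (ℕₚ.≤-pred (≡.subst (suc (t + z) <_) (≡.sym (1+t+[p∸t∸1]≡p t<p)) 1+t+z<p))
      shape : ∀ w c t z → w + (suc c + suc (t + z)) ≡ suc w + (suc c + (t + z))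
      shape = solve 4 (λ w c t z → w :+ ((con 1 :+ c) :+ (con 1 :+ (t :+ z))) := (con 1 :+ w) :+ ((con 1 :+ c) :+ (t :+ z))) ≡.refl

    ν≡Y : ∀ {t y} → s ≡ suc t → y < r → ν t y ≡ Y y
    ν≡Y {t} {y} s≡1+t y<r with split c y
    ... | below y<c      = ≡.trans (ν-below t y<c) (≡.sym (Y-below y<c))
    ... | above zero     = begin
      ν t (c + 0)            ≡⟨ cong (ν t) (ℕₚ.+-identityʳ c) ⟩
      ν t c                  ≡⟨ ν-corner t ⟩
      (w + t + 1) + c        ≡⟨ shape w t c ⟩
      (w + suc t) + (c + 0)  ≡⟨ cong (λ i → (w + i) + (c + 0)) s≡1+t ⟨
      (w + s) + (c + 0)      ≡⟨ Y-above (s≤s z≤n) ⟨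
      Y (c + 0)              ∎
      where
      open ≡.≡-Reasoning
      shape : ∀ w t c → (w + t + 1) + c ≡ (w + suc t) + (c + 0)
      shape = solve 3 (λ w t c → ((w :+ t) :+ con 1) :+ c := (w :+ (con 1 :+ t)) :+ (c :+ con 0)) ≡.refl
    ... | above (suc z)  = begin
      ν t (c + suc z)        ≡⟨ cong (ν t) (ℕₚ.+-suc c z) ⟩
      ν t (suc (c + z))      ≡⟨ ν-above t z<p ⟩
      (w + s) + suc (c + z)  ≡⟨ cong ((w + s) +_) (ℕₚ.+-suc c z) ⟨
      (w + s) + (c + suc z)  ≡⟨ Y-above (s≤s z<p) ⟨
      Y (c + suc z)          ∎
      where
      open ≡.≡-Reasoning
      z<p : z < p
      z<p = ℕₚ.+-cancelˡ-< c z p (ℕₚ.≤-pred (≡.subst (_< r) (ℕₚ.+-suc c z) y<r))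

-- The relation for rectangular shapes

module Rectangles {a ℓ} (R : CommutativeRing a ℓ) where

  open CommutativeRing R hiding (zero)
  open Over R using (Mat; sgn; sumTo; S; entry)
  open import Algebra.Properties.Ring ring using (-‿involutive; -0#≈0#; xyx⁻¹≈y; ⁻¹-anti-homo‿-)
  open Minors R
  open Partitions
  open import Relation.Binary.Reasoning.Setoid setoid

  opaque
    unfolding Det

    S≈Δ : ∀ {N} (U : Mat N) r L → nonincr L ≡ true → part L r ≡ 0 → part L 0 ℕ.+ r ≤ N →
          S U r (just L) ≈ Δ (entry U) r (columns r L)
    S≈Δ U r L L↓ Lᵣ≡0 L₀+r≤N rewrite L↓ | Lᵣ≡0 | ≤ᵇ-true L₀+r≤N = refl

  S-rect≈Δ : ∀ {N} (U : Mat N) {r c} p q → r ≡ c ℕ.+ p → q ℕ.+ r ≤ N →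
             S U r (rect p q) ≈ Δ (entry U) r (columns r (boxParts 0 p q 0))
  S-rect≈Δ {N} U {r} {c} p q r≡ q+r≤N = begin
    S U r (rect p q)                              ≡⟨ cong (S U r) (box≡boxParts p (≡.sym (ℕₚ.+-identityʳ p))) ⟩
    S U r (just L)                                ≈⟨ S≈Δ U r L (boxParts-nonincr 0 p z≤n) Lᵣ≡0 L₀+r≤N ⟩
    Δ (entry U) r (columns r L)                   ∎
    where
    L : List ℕ
    L = boxParts 0 p q 0
    Lᵣ≡0 : part L r ≡ 0
    Lᵣ≡0 = ≡.trans (cong (part L) (≡.trans r≡ (ℕₚ.+-comm c p))) (boxParts₀-beyond 0 p q c)
    L₀+r≤N : part L 0 ℕ.+ r ≤ N
    L₀+r≤N = ℕₚ.≤-trans (ℕₚ.+-monoˡ-≤ r (boxParts₀-head≤ p z≤n)) q+r≤N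

  S-boxL≈Δ : ∀ {N} (U : Mat N) {r c} p q k → r ≡ suc (c ℕ.+ p) → k ≤ q → q ℕ.+ r ≤ N →
             S U r (boxL p q k) ≈ Δ (entry U) r (columns r (boxParts 0 p q k))
  S-boxL≈Δ {N} U {r} {c} p q k r≡ k≤q q+r≤N = begin
    S U r (boxL p q k)                            ≡⟨ cong (S U r) (box≡boxParts p (≡.sym (ℕₚ.+-identityʳ p))) ⟩
    S U r (just L)                                ≈⟨ S≈Δ U r L (boxParts-nonincr 0 p k≤q) Lᵣ≡0 L₀+r≤N ⟩
    Δ (entry U) r (columns r L)                   ∎
    where
    L : List ℕ
    L = boxParts 0 p q k
    Lᵣ≡0 : part L r ≡ 0
    Lᵣ≡0 = ≡.trans (cong (part L) (≡.trans r≡ (ℕₚ.+-comm (suc c) p))) (boxParts-beyond 0 p q k c)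
    L₀+r≤N : part L 0 ℕ.+ r ≤ N
    L₀+r≤N = ℕₚ.≤-trans (ℕₚ.+-monoˡ-≤ r (boxParts₀-head≤ p k≤q)) q+r≤N

  S-boxU≈Δ : ∀ {N} (U : Mat N) {r c p} l d q → p ≡ d ℕ.+ l → r ≡ c ℕ.+ (d ℕ.+ l) → suc q ℕ.+ r ≤ N →
             S U r (boxU p q l) ≈ Δ (entry U) r (columns r (boxParts l d q 0))
  S-boxU≈Δ {N} U {r} {c} {p} l d q p≡ r≡ 1+q+r≤N = begin
    S U r (boxU p q l)                            ≡⟨ cong (S U r) (box≡boxParts d p≡) ⟩
    S U r (just L)                                ≈⟨ S≈Δ U r L (boxParts-nonincr l d z≤n) Lᵣ≡0 L₀+r≤N ⟩
    Δ (entry U) r (columns r L)                   ∎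
    where
    L : List ℕ
    L = boxParts l d q 0
    shape : ∀ c d l → c ℕ.+ (d ℕ.+ l) ≡ l ℕ.+ (d ℕ.+ c)
    shape = solve 3 (λ c d l → c :+ (d :+ l) := l :+ (d :+ c)) ≡.refl
    Lᵣ≡0 : part L r ≡ 0
    Lᵣ≡0 = ≡.trans (cong (part L) (≡.trans r≡ (shape c d l))) (boxParts₀-beyond l d q c)
    L₀+r≤N : part L 0 ℕ.+ r ≤ N
    L₀+r≤N = ℕₚ.≤-trans (ℕₚ.+-monoˡ-≤ r (boxParts-head≤ l d z≤n)) 1+q+r≤N

  module Specialisation {N} (U : Mat N) (c w p s : ℕ) (s≤p : s ≤ p)
                        (bound : w ℕ.+ s ℕ.+ suc (c ℕ.+ p) ≤ N) where

    open RectangleColumns c w p s public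

    E : Matrix
    E = entry U

    c<r : c < r
    c<r = s≤s (ℕₚ.m≤m+n c p)

    bound-w : w ℕ.+ r ≤ N
    bound-w = ℕₚ.≤-trans (ℕₚ.+-monoˡ-≤ r (ℕₚ.m≤m+n w s)) bound

    bound-w+s+1 : suc (w ℕ.+ s) ℕ.+ n ≤ N
    bound-w+s+1 = ≡.subst (_≤ N) (ℕₚ.+-suc (w ℕ.+ s) n) bound

    bound-w+1 : suc w ℕ.+ n ≤ N
    bound-w+1 = ℕₚ.≤-trans (ℕₚ.+-monoˡ-≤ n (s≤s (ℕₚ.m≤m+n w s))) bound-w+s+1

    S-κ : S U r (rect p w) ≈ Δ E r κ
    S-κ = S-rect≈Δ U p w ≡.refl bound-w

    S-ι : S U n (rect p (suc (w ℕ.+ s))) ≈ Δ E n ι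
    S-ι = S-rect≈Δ U p (suc (w ℕ.+ s)) ≡.refl bound-w+s+1

    S-μ : S U r (rect p (w ℕ.+ s)) ≈ Δ E r μ
    S-μ = S-rect≈Δ U p (w ℕ.+ s) ≡.refl bound

    S-ρ : S U n (rect p (suc w)) ≈ Δ E n ρ
    S-ρ = S-rect≈Δ U p (suc w) ≡.refl bound-w+1

    S-Y : S U r (rect (suc p) (w ℕ.+ s)) ≈ Δ E r Y
    S-Y = S-rect≈Δ U (suc p) (w ℕ.+ s) (≡.sym (ℕₚ.+-suc c p)) bound

    S-ν : ∀ {t} → t < s → S U r (boxL p (w ℕ.+ s) (w ℕ.+ t ℕ.+ 1)) ≈ Δ E r (ν t)
    S-ν {t} t<s = S-boxL≈Δ U p (w ℕ.+ s) (w ℕ.+ t ℕ.+ 1) ≡.refl k≤ bound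
      where
      k≤ : w ℕ.+ t ℕ.+ 1 ≤ w ℕ.+ s
      k≤ = ≡.subst (_≤ w ℕ.+ s) (≡.sym (ℕₚ.+-assoc w t 1)) (ℕₚ.+-monoʳ-≤ w (≡.subst (_≤ s) (ℕₚ.+-comm 1 t) t<s))

    S-ω : ∀ {t} → t < p → S U n (boxU (p ∸ 1) w (p ∸ t ∸ 1)) ≈ Δ E n (ω t)
    S-ω {t} t<p = S-boxU≈Δ U {c = suc c} (p ∸ t ∸ 1) t w (cong (_∸ 1) (≡.sym (1+t+[p∸t∸1]≡p t<p))) (nω≡ t<p) bound-w+1

    F : ℕ → Carrier
    F j = sgn j (Δ E r (cons (κ j) ι) * Δ E n (κ ∘ skip j))

    T₁ : Carrier
    T₁ = S U r (rect p (w ℕ.+ s)) * S U n (rect p (suc w))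

    X : ℕ → Carrier
    X t = - sgn t (S U r (boxL p (w ℕ.+ s) (w ℕ.+ t ℕ.+ 1)) * S U n (boxU (p ∸ 1) w (p ∸ t ∸ 1)))

    F-below : ∀ {j} → j < c → F j ≈ 0#
    F-below {j} j<c = sgn≈0 j (*-≈0ˡ _ (Det-equalCols r j (cols (cons (κ j) ι) E) 1+j<r
                        (λ i → reflexive (cong (E i) (κ≡ι-below j<c)))))
      where
      1+j<r : suc j < r
      1+j<r = s≤s (ℕₚ.<-≤-trans j<c (ℕₚ.m≤m+n c p))

    F-at : F c ≈ T₁
    F-at = begin
      sgn c (Δ E r (cons (κ c) ι) * Δ E n (κ ∘ skip c))
        ≈⟨ sgn-cong c (*-cong (trans (Δ-cong E r cons-κ-ι≡μ∘rotate) (Det-rotateCols c r (cols μ E) c<r))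
                              (Δ-cong E n κ∘skip≡ρ)) ⟩
      sgn c (sgn c (Δ E r μ) * Δ E n ρ)
        ≈⟨ sgn-sgn-* c _ _ ⟩
      Δ E r μ * Δ E n ρ
        ≈⟨ *-cong S-μ S-ρ ⟨
      T₁ ∎

    F-mid : ∀ {t} → t < s → F (suc c ℕ.+ t) ≈ X t
    F-mid {t} t<s = begin
      sgn (suc c ℕ.+ t) (Δ E r (cons (κ (suc c ℕ.+ t)) ι) * Δ E n (κ ∘ skip (suc c ℕ.+ t)))
        ≈⟨ sgn-cong (suc c ℕ.+ t) (*-cong (trans (Δ-cong E r (cons-κ-ι≡ν∘rotate t<p)) (Det-rotateCols c r (cols (ν t) E) c<r))
                                          (Δ-cong E n (κ∘skip≡ω t<p))) ⟩
      - sgn (c ℕ.+ t) (sgn c (Δ E r (ν t)) * Δ E n (ω t))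
        ≈⟨ -‿cong (trans (sgn-+ℕ c t _) (sgn-comm c t _)) ⟩
      - sgn t (sgn c (sgn c (Δ E r (ν t)) * Δ E n (ω t)))
        ≈⟨ -‿cong (sgn-cong t (sgn-sgn-* c _ _)) ⟩
      - sgn t (Δ E r (ν t) * Δ E n (ω t))
        ≈⟨ -‿cong (sgn-cong t (*-cong (S-ν t<s) (S-ω t<p))) ⟨
      X t ∎
      where
      t<p : t < p
      t<p = ℕₚ.<-≤-trans t<s s≤p

    F-above : ∀ {i} → i < p ∸ s → F (suc c ℕ.+ (s ℕ.+ i)) ≈ 0#
    F-above {i} i<d = sgn≈0 j (*-≈0ˡ _ (Det-equalCols r (c ℕ.+ i) (cols (cons (κ j) ι) E) (s≤s (ℕₚ.+-monoʳ-< c i<p))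
                        (λ k → reflexive (cong (E k) (κ≡ι-above s+i<p)))))
      where
      j : ℕ
      j = suc c ℕ.+ (s ℕ.+ i)
      s+i<p : s ℕ.+ i < p
      s+i<p = ≡.subst (s ℕ.+ i <_) (ℕₚ.m+[n∸m]≡n s≤p) (ℕₚ.+-monoʳ-< s i<d)
      i<p : i < p
      i<p = ℕₚ.≤-<-trans (ℕₚ.m≤n+m i s) s+i<p

    ∑F≈T₁+∑X : ∑< r F ≈ T₁ + ∑< s X
    ∑F≈T₁+∑X = begin
      ∑< r F
        ≡⟨ cong (λ k → ∑< (suc c ℕ.+ k) F) (≡.sym (ℕₚ.m+[n∸m]≡n s≤p)) ⟩
      ∑< (suc c ℕ.+ (s ℕ.+ d)) F
        ≈⟨ ∑<-split (suc c) (s ℕ.+ d) F ⟩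
      ∑< (suc c) F + ∑< (s ℕ.+ d) (λ i → F (suc c ℕ.+ i))
        ≈⟨ +-cong (∑<-last c F) (∑<-split s d _) ⟩
      (∑< c F + F c) + (∑< s (λ t → F (suc c ℕ.+ t)) + ∑< d (λ i → F (suc c ℕ.+ (s ℕ.+ i))))
        ≈⟨ +-cong (+-cong (∑<-zero c (λ _ → F-below)) F-at)
                  (+-cong (∑<-cong s (λ _ → F-mid)) (∑<-zero d (λ _ → F-above))) ⟩
      (0# + T₁) + (∑< s X + 0#)
        ≈⟨ +-cong (+-identityˡ T₁) (+-identityʳ _) ⟩
      T₁ + ∑< s X ∎
      where
      d : ℕ
      d = p ∸ s

    plücker-rectangles : T₁ + ∑< s X ≈ S U r (rect p w) * S U n (rect p (suc (w ℕ.+ s)))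
    plücker-rectangles = begin
      T₁ + ∑< s X         ≈⟨ ∑F≈T₁+∑X ⟨
      ∑< r F              ≈⟨ plücker E n κ ι ⟩
      Δ E n ι * Δ E r κ   ≈⟨ *-comm _ _ ⟩
      Δ E r κ * Δ E n ι   ≈⟨ *-cong S-κ S-ι ⟨
      S U r (rect p w) * S U n (rect p (suc (w ℕ.+ s))) ∎

    -- For t = s - 1 the symbol [p | w+s]_{w+t+1} is [p+1 | w+s].
    X-last : ∀ {t} → s ≡ suc t →
             X t ≈ - sgn t (S U r (rect (suc p) (w ℕ.+ s)) * S U n (boxU (p ∸ 1) w (p ∸ t ∸ 1)))
    X-last {t} s≡1+t = -‿cong (sgn-cong t (*-congʳ (begin
      S U r (boxL p (w ℕ.+ s) (w ℕ.+ t ℕ.+ 1))   ≈⟨ S-ν t<s ⟩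
      Δ E r (ν t)                                ≈⟨ Δ-cong E r (ν≡Y s≡1+t) ⟩
      Δ E r Y                                    ≈⟨ S-Y ⟨
      S U r (rect (suc p) (w ℕ.+ s))             ∎)))
      where
      t<s : t < s
      t<s = ≡.subst (t <_) (≡.sym s≡1+t) (ℕₚ.n<1+n t)

  -- The identity of the theorem in terms of w = q - a and m = a + b.
  Relation : ∀ {N} → Mat N → (r p w m : ℕ) → Set ℓ
  Relation U r p w m =
    sgn m (S U r (rect (p ℕ.+ 1) (w ℕ.+ m ∸ 1)) * S U (r ∸ 1) (boxU (p ∸ 1) w (p ℕ.+ 1 ∸ m)))
    ≈ (S U r (rect p (w ℕ.+ m ∸ 1)) * S U (r ∸ 1) (rect p (w ℕ.+ 1))
       - S U r (rect p w) * S U (r ∸ 1) (rect p (w ℕ.+ m)))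
      + sumTo (m ∸ 2) (λ t → - sgn t (S U r (boxL p (w ℕ.+ m ∸ 1) (w ℕ.+ t ℕ.+ 1))
                                     * S U (r ∸ 1) (boxU (p ∸ 1) w (p ∸ t ∸ 1))))

  -- For m = 1 the symbol [ p - 1 | w ]^p is undefined and both sides vanish.
  relation₁ : ∀ {N} (U : Mat N) n p w → Relation U (suc n) (suc p) w 1
  relation₁ U n p w rewrite ℕₚ.m+n∸n≡m w 1 =
    trans (trans (-‿cong (*-≈0ʳ _ (reflexive (cong (S U n) (box-undefined (ℕₚ.m<m+n p (s≤s z≤n))))))) -0#≈0#)
          (sym (trans (+-identityʳ _) (-‿inverseʳ _)))

  x+[y-z]≈w⇒z≈[x-w]+y : ∀ x y z w → x + (y - z) ≈ w → z ≈ (x - w) + y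
  x+[y-z]≈w⇒z≈[x-w]+y x y z w x+[y-z]≈w = begin
    z                          ≈⟨ xyx⁻¹≈y (x + y) z ⟨
    (x + y) + z - (x + y)      ≈⟨ +-assoc _ _ _ ⟩
    (x + y) + (z - (x + y))    ≈⟨ +-congˡ (⁻¹-anti-homo‿- (x + y) z) ⟨
    (x + y) - ((x + y) - z)    ≈⟨ +-congˡ (-‿cong (trans (+-assoc x y (- z)) x+[y-z]≈w)) ⟩
    (x + y) - w                ≈⟨ +-assoc x y (- w) ⟩
    x + (y - w)                ≈⟨ +-congˡ (+-comm y (- w)) ⟩
    x + (- w + y)              ≈⟨ +-assoc x (- w) y ⟨
    (x - w) + y                ∎

  -- Up to sign, the last term X t of plücker-rectangles is the left-hand side; solve for it.
  relation-core : ∀ {N} (U : Mat N) c p w s → s ≤ suc p → w ℕ.+ s ℕ.+ suc (c ℕ.+ suc p) ≤ N →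
                  Relation U (suc (c ℕ.+ suc p)) (suc p) w (suc s)
  relation-core U c p w zero    _   _     = relation₁ U (c ℕ.+ suc p) p w
  relation-core U c p w (suc t) s≤p bound
    rewrite ℕₚ.+-suc w (suc t) | ℕₚ.+-comm p 1 | ℕₚ.+-comm w 1 = begin
      sgn (suc (suc t)) L        ≈⟨ -‿involutive _ ⟩
      sgn t L                    ≈⟨ x+[y-z]≈w⇒z≈[x-w]+y T₁ (∑< t X) (sgn t L) T₂ ∑X≈ ⟩
      (T₁ - T₂) + ∑< t X         ≈⟨ +-congˡ (sumTo≈∑< t X) ⟨
      (T₁ - T₂) + sumTo t X      ∎
    where
    open Specialisation U c w (suc p) (suc t) s≤p bound
    L T₂ : Carrier
    L  = S U r (rect (suc (suc p)) (w ℕ.+ suc t)) * S U n (boxU p w (p ∸ t))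
    T₂ = S U r (rect (suc p) w) * S U n (rect (suc p) (suc (w ℕ.+ suc t)))
    X-t≈ : X t ≈ - sgn t L
    X-t≈ = trans (X-last ≡.refl) (-‿cong (sgn-cong t (*-congˡ (reflexive (cong (λ k → S U n (boxU p w k)) p+1∸t∸1≡p∸t)))))
      where
      p+1∸t∸1≡p∸t : suc p ∸ t ∸ 1 ≡ p ∸ t
      p+1∸t∸1≡p∸t = ≡.trans (ℕₚ.∸-+-assoc (suc p) t 1) (cong (suc p ∸_) (ℕₚ.+-comm t 1))
    ∑X≈ : T₁ + (∑< t X - sgn t L) ≈ T₂
    ∑X≈ = begin
      T₁ + (∑< t X - sgn t L)  ≈⟨ +-congˡ (+-congˡ X-t≈) ⟨
      T₁ + (∑< t X + X t)      ≈⟨ +-congˡ (∑<-last t X) ⟨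
      T₁ + ∑< (suc t) X        ≈⟨ plücker-rectangles ⟩
      T₂                       ∎

  relation : ∀ {N} (U : Mat N) r p w m → 1 ≤ p → 1 ≤ m → m ≤ p ℕ.+ 1 → p ℕ.+ 1 ≤ r →
             w ℕ.+ m ℕ.+ r ≤ N ℕ.+ 1 → Relation U r p w m
  relation {N} U (suc n) (suc p) w (suc s) (s≤s z≤n) (s≤s z≤n) (s≤s s≤p+1) (s≤s p+1≤n) bound =
    ≡.subst (λ k → Relation U (suc k) (suc p) w (suc s)) c+p+1≡n
      (relation-core U c p w s (≡.subst (s ≤_) (ℕₚ.+-comm p 1) s≤p+1) bound′)
    where
    1+p≤n : suc p ≤ n
    1+p≤n = ≡.subst (_≤ n) (ℕₚ.+-comm p 1) p+1≤n
    c : ℕ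
    c = n ∸ suc p
    c+p+1≡n : c ℕ.+ suc p ≡ n
    c+p+1≡n = ℕₚ.m∸n+n≡m 1+p≤n
    bound′ : w ℕ.+ s ℕ.+ suc (c ℕ.+ suc p) ≤ N
    bound′ = ≡.subst (λ k → w ℕ.+ s ℕ.+ suc k ≤ N) (≡.sym c+p+1≡n)
               (ℕₚ.≤-pred (≡.subst₂ _≤_ (cong (ℕ._+ suc n) (ℕₚ.+-suc w s)) (ℕₚ.+-comm N 1) bound))

open Rectangles using (relation)

n≤m⇒m+o≡[m∸n]+[n+o] : ∀ {m n} o → n ≤ m → m ℕ.+ o ≡ m ∸ n ℕ.+ (n ℕ.+ o)
n≤m⇒m+o≡[m∸n]+[n+o] {m} {n} o n≤m = ≡.trans (cong (ℕ._+ o) (≡.sym (ℕₚ.m∸n+n≡m n≤m))) (ℕₚ.+-assoc (m ∸ n) n o)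

theorem4p5 : ∀ {c ℓ} (R : CommutativeRing c ℓ) (N : ℕ)
               (X X₋ X₀ X₊ : Over.Mat R N) →
               Over.IsGaussDecomposition R N X X₋ X₀ X₊ →
               (r p q a b : ℕ) →
               1 ≤ p → 1 ≤ q → a ≤ q → a ℕ.+ b ≤ p ℕ.+ 1 →
               1 ≤ a ℕ.+ b →
               p ℕ.+ 1 ≤ r → q ℕ.+ b ℕ.+ r ≤ N ℕ.+ 1 →
               let open CommutativeRing R
                   open Over R
               in sgn (a ℕ.+ b)
                    (S X₊ r (rect (p ℕ.+ 1) (q ℕ.+ b ∸ 1))
                      * S X₊ (r ∸ 1) (boxU (p ∸ 1) (q ∸ a) (p ℕ.+ 1 ∸ (a ℕ.+ b))))
                  ≈ (S X₊ r (rect p (q ℕ.+ b ∸ 1)) * S X₊ (r ∸ 1) (rect p (q ∸ a ℕ.+ 1))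
                     - S X₊ r (rect p (q ∸ a)) * S X₊ (r ∸ 1) (rect p (q ℕ.+ b)))
                    + sumTo (a ℕ.+ b ∸ 2)
                        (λ t → - sgn t
                                 (S X₊ r (boxL p (q ℕ.+ b ∸ 1) (q ∸ a ℕ.+ t ℕ.+ 1))
                                   * S X₊ (r ∸ 1) (boxU (p ∸ 1) (q ∸ a) (p ∸ t ∸ 1))))
theorem4p5 R N _ _ _ X₊ _ r p q a b 1≤p _ a≤q a+b≤p+1 1≤a+b p+1≤r bound
  rewrite n≤m⇒m+o≡[m∸n]+[n+o] b a≤q =
    relation R X₊ r p (q ∸ a) (a ℕ.+ b) 1≤p 1≤a+b a+b≤p+1 p+1≤r bound
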